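{- Let $k\ge 1$ and $n$ be integers. Suppose $G=(G_1,\ldots,G_{n+k})$ is a collection of $n+k$ graphs on a common vertex set $V$ with $|V|=n$, and $\sigma_2(G_i)\ge n-2$ for all $i\in[n+k]$. Then at least one of the following holds: (A1') $G$ has a rainbow Hamiltonian path; (A2') there is $\ell\in[n-1]$ such that $G_1=G_2=\cdots=G_{n+k}$ and this common graph is a disjoint union of a clique on $\ell$ vertices and a clique on $n-\ell$ vertices; (A3') $n$ is even and there is a partition $V=X\cup Y$ with $|X|=n/2-1$, $|Y|=n/2+1$ such that for every $i\in[n+k]$, $Y$ is an independent set in $G_i$.
   Context: For a graph $F$, $\sigma_2(F)=\min\{d_F(x)+d_F(y): x\ne y,\ xy\notin E(F)\}$. For a collection $G=(G_1,\ldots,G_m)$ of graphs on a common vertex set $V$ and a graph $H$ with $V(H)\subseteq V$, $G$ contains a rainbow $H$ if there is an injection $c:E(H)\to[m]$ with $e\in E(G_{c(e)})$ for every $e\in E(H)$. A rainbow Hamiltonian path is a rainbow path containing all vertices of $V$. -}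

module Defs where

open import Data.Nat using (ℕ; zero; suc; _+_; _∸_; _≤_)
open import Data.Bool using (Bool; true; false)
open import Data.Fin using (Fin; inject₁) renaming (suc to fsuc)
open import Data.Fin.Subset using (Subset; ∣_∣; _∈_)
open import Data.Vec using (tabulate)
open import Data.Product using (Σ; _×_; ∃)
open import Data.Unit using (⊤)
open import Function.Definitions using (Injective)
open import Relation.Binary.PropositionalEquality using (_≡_; _≢_)
open import Relation.Nullary using (¬_)

record Graph (n : ℕ) : Set where
  field
    adj   : Fin n → Fin n → Bool
    sym   : ∀ x y → adj x y ≡ adj y x
    irrefl : ∀ x → adj x x ≡ false
open Graph public

Edge : ∀ {n} → Graph n → Fin n → Fin n → Set
Edge F x y = adj F x y ≡ true

N : ∀ {n} → Graph n → Fin n → Subset n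
N F x = tabulate (adj F x)

deg : ∀ {n} → Graph n → Fin n → ℕ
deg F x = ∣ N F x ∣

-- σ₂(F) ≥ s : every pair of distinct non-adjacent vertices has degree sum ≥ s
-- (vacuous when F is complete, matching σ₂ = min ∅ = ∞).
σ₂≥ : ∀ {n} → Graph n → ℕ → Set
σ₂≥ {n} F s = ∀ x y → x ≢ y → adj F x y ≡ false → s ≤ deg F x + deg F y

Collection : ℕ → ℕ → Set
Collection m n = Fin m → Graph n

RainbowHamPath : ∀ {m n} → Collection m n → Set
RainbowHamPath {m} {zero} G = ⊤
RainbowHamPath {m} {suc n} G =
  Σ (Fin (suc n) → Fin (suc n)) λ v →
  Σ (Fin n → Fin m) λ c →
    Injective _≡_ _≡_ v
  × (∀ x → ∃ λ i → v i ≡ x)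
  × Injective _≡_ _≡_ c
  × (∀ i → Edge (G (c i)) (v (inject₁ i)) (v (fsuc i)))

-- (A2'): there is ℓ ∈ [n-1] and S ⊆ V with |S| = ℓ such that every G_i equals
-- the disjoint union of the clique on S and the clique on V \ S.
TwoCliques : ∀ {m n} → Collection m n → Set
TwoCliques {m} {n} G =
  Σ ℕ λ ℓ → Σ (Subset n) λ S →
    1 ≤ ℓ × ℓ ≤ n ∸ 1 × ∣ S ∣ ≡ ℓ
  × (∀ i x y → (Edge (G i) x y → (x ≢ y × (x ∈ S → y ∈ S) × (y ∈ S → x ∈ S)))
             × ((x ≢ y × (x ∈ S → y ∈ S) × (y ∈ S → x ∈ S)) → Edge (G i) x y))

-- (A3'): n = 2h is even and there is Y ⊆ V with |Y| = h + 1 (so X = V \ Y has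
-- size h - 1) which is independent in every G_i.
BigIndependent : ∀ {m n} → Collection m n → Set
BigIndependent {m} {n} G =
  Σ ℕ λ h → Σ (Subset n) λ Y →
    n ≡ h + h × ∣ Y ∣ ≡ suc h
  × (∀ i x y → x ∈ Y → y ∈ Y → adj (G i) x y ≡ false)

{-# OPTIONS --safe #-}
-- Grow a rainbow path v₀ … vₛ one edge at a time.  While s + 2 ≤ n there is an outside vertex w
-- and, as there are more than n colours, three colours f₁ f₂ f₃ unused on the path.  When no
-- Pósa rotation, recolouring, or closing of the path into a rainbow cycle lets it grow, the ends
-- v₀ and vₛ see only path vertices in these colours and chords from v₀ and from vₛ never cross.
-- Counting those chords against σ₂ ≥ n − 2, as in the Bondy–Chvátal argument, gives s = n − 2,
-- and comparing with the neighbourhood of w puts every neighbour of v₀ and of w at an odd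
-- position.  Repeating this for every colour and, after rotations, for every vertex at an even
-- position shows that w together with the even positions is independent in every Gᵢ (A3').
-- In the cycle case, if no colour joins the cycle to the rest, σ₂ makes both sides cliques (A2').
module Submission where

open import Data.Bool using (Bool; true; false; not; _∧_; _∨_; _xor_)
import Data.Bool.Properties as Boolₚ
open import Data.Empty using (⊥; ⊥-elim)
open import Data.Fin using (Fin; toℕ; fromℕ<; inject₁) renaming (zero to fzero; suc to fsuc)
import Data.Fin.Properties as Finₚ
open import Data.Fin.Subset using (Subset; ∣_∣; _∈_)
open import Data.Nat
open import Data.Nat.Properties
open import Algebra.Properties.CommutativeSemigroup +-commutativeSemigroup using (interchange)
open import Data.Nat.Solver using (module +-*-Solver)
open import Data.Product using (Σ; ∃; _×_; _,_; proj₁; proj₂)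
open import Data.Sum using (_⊎_; inj₁; inj₂)
open import Data.Unit using (tt)
open import Data.Vec using (tabulate)
open import Data.Vec.Properties using (lookup∘tabulate; []=⇒lookup; lookup⇒[]=)
open import Function using (_∘_; _⟨_⟩_)
open import Relation.Binary.Definitions using (tri<; tri≈; tri>)
open import Relation.Binary.PropositionalEquality
open import Relation.Nullary
open import Relation.Nullary.Decidable using (dec-true; dec-false)
open import Defs using (Graph; adj; Edge; deg; σ₂≥; Collection; RainbowHamPath; TwoCliques; BigIndependent)

open Graph using () renaming (sym to adj-sym; irrefl to adj-irrefl)
open +-*-Solver using (solve; _:+_; _:=_; con)

indicator : Bool → ℕ
indicator true  = 1
indicator false = 0

indicator≤1 : ∀ b → indicator b ≤ 1
indicator≤1 true  = s≤s z≤n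
indicator≤1 false = z≤n

count : (ℕ → Bool) → ℕ → ℕ
count p zero    = 0
count p (suc a) = count p a + indicator (p a)

count≤ : ∀ p a → count p a ≤ a
count≤ p zero    = z≤n
count≤ p (suc a) = subst (_≤ suc a) (+-comm (indicator (p a)) (count p a))
  (+-mono-≤ (indicator≤1 (p a)) (count≤ p a))

count-cong : ∀ p q a → (∀ x → x < a → p x ≡ q x) → count p a ≡ count q a
count-cong p q zero    p≗q = refl
count-cong p q (suc a) p≗q =
  cong₂ _+_ (count-cong p q a (λ x x<a → p≗q x (m<n⇒m<1+n x<a))) (cong indicator (p≗q a (n<1+n a)))

count-true : ∀ a → count (λ _ → true) a ≡ a
count-true zero    = refl
count-true (suc a) = trans (cong (_+ 1) (count-true a)) (+-comm a 1)

count-false : ∀ p a → (∀ x → x < a → p x ≡ false) → count p a ≡ 0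
count-false p a p≗false = count-cong p (λ _ → false) a p≗false ⟨ trans ⟩ zeros a
  where
  zeros : ∀ a → count (λ _ → false) a ≡ 0
  zeros zero    = refl
  zeros (suc a) = trans (+-identityʳ _) (zeros a)

count-shift : ∀ p a → count p (suc a) ≡ indicator (p 0) + count (p ∘ suc) a
count-shift p zero    = +-comm 0 (indicator (p 0))
count-shift p (suc a) = cong (_+ indicator (p (suc a))) (count-shift p a) ⟨ trans ⟩ +-assoc (indicator (p 0)) _ _

Disjoint : (ℕ → Bool) → (ℕ → Bool) → ℕ → Set
Disjoint p q a = ∀ x → x < a → p x ≡ true → q x ≡ true → ⊥

count-∨ : ∀ p q a → Disjoint p q a → count p a + count q a ≡ count (λ x → p x ∨ q x) a
count-∨ p q zero    disj = refl
count-∨ p q (suc a) disj = begin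
  (count p a + indicator (p a)) + (count q a + indicator (q a))
    ≡⟨ interchange (count p a) (indicator (p a)) (count q a) (indicator (q a)) ⟩
  (count p a + count q a) + (indicator (p a) + indicator (q a))
    ≡⟨ cong₂ _+_ (count-∨ p q a (λ x x<a → disj x (m<n⇒m<1+n x<a)))
                 (indicator-∨ (p a) (q a) (disj a (n<1+n a))) ⟩
  count (λ x → p x ∨ q x) a + indicator (p a ∨ q a) ∎
  where
  open ≡-Reasoning
  indicator-∨ : ∀ b c → (b ≡ true → c ≡ true → ⊥) → indicator b + indicator c ≡ indicator (b ∨ c)
  indicator-∨ true  true  b∧c = ⊥-elim (b∧c refl refl)
  indicator-∨ true  false _   = refl
  indicator-∨ false c     _   = refl

count-disjoint : ∀ p q a → Disjoint p q a → count p a + count q a ≤ a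
count-disjoint p q a disj = subst (_≤ a) (sym (count-∨ p q a disj)) (count≤ _ a)

count+count-not : ∀ p a → count p a + count (not ∘ p) a ≡ a
count+count-not p a = begin
  count p a + count (not ∘ p) a         ≡⟨ count-∨ p (not ∘ p) a (λ x _ px ¬px → Boolₚ.not-¬ refl (trans px (sym ¬px))) ⟩
  count (λ x → p x ∨ not (p x)) a       ≡⟨ count-cong _ _ a (λ x _ → Boolₚ.∨-inverseʳ (p x)) ⟩
  count (λ _ → true) a                  ≡⟨ count-true a ⟩
  a                                     ∎
  where open ≡-Reasoning

count< : ∀ p a x → x < a → p x ≡ false → suc (count p a) ≤ a
count< p (suc a) x x<1+a px with m<1+n⇒m<n∨m≡n x<1+a
... | inj₁ x<a = subst (_≤ suc a) (+-comm (indicator (p a)) (suc (count p a)))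
  (+-mono-≤ (indicator≤1 (p a)) (count< p a x x<a px))
... | inj₂ refl = s≤s (subst (_≤ x) (sym (cong (λ b → count p x + indicator b) px ⟨ trans ⟩ +-identityʳ _))
  (count≤ p x))

count-cover : ∀ p q a → Disjoint p q a → a ≤ count p a + count q a →
  ∀ x → x < a → p x ≡ false → q x ≡ true
count-cover p q a disj a≤ x x<a px with q x in qx
... | true  = refl
... | false = ⊥-elim (<-irrefl refl (≤-trans (count< (λ x → p x ∨ q x) a x x<a (cong₂ _∨_ px qx))
  (subst (a ≤_) (count-∨ p q a disj) a≤)))

erase : (ℕ → Bool) → ℕ → ℕ → Bool
erase q y x = q x ∧ not (does (x ≟ y))

erase-≢ : ∀ q {x y} → x ≢ y → erase q y x ≡ q x
erase-≢ q {x} {y} x≢y rewrite dec-false (x ≟ y) x≢y = Boolₚ.∧-identityʳ (q x)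

erase-self : ∀ q y → erase q y y ≡ false
erase-self q y rewrite dec-true (y ≟ y) refl = Boolₚ.∧-zeroʳ (q y)

count-erase : ∀ q a y → y < a → q y ≡ true → count q a ≡ suc (count (erase q y) a)
count-erase q (suc a) y y<1+a qy with m<1+n⇒m<n∨m≡n y<1+a
... | inj₁ y<a = cong₂ _+_ (count-erase q a y y<a qy)
  (cong indicator (sym (erase-≢ q (λ a≡y → <⇒≢ y<a (sym a≡y)))))
... | inj₂ refl = begin
  count q y + indicator (q y)
    ≡⟨ cong₂ _+_ (count-cong q (erase q y) y (λ x x<y → sym (erase-≢ q (<⇒≢ x<y)))) (cong indicator qy) ⟩
  count (erase q y) y + 1
    ≡⟨ +-comm _ 1 ⟩
  suc (count (erase q y) y)
    ≡⟨ cong suc (sym (+-identityʳ _)) ⟩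
  suc (count (erase q y) y + 0)
    ≡⟨ cong (λ b → suc (count (erase q y) y + indicator b)) (sym (erase-self q y)) ⟩
  suc (count (erase q y) y + indicator (erase q y y)) ∎
  where open ≡-Reasoning

count-≤-injection : ∀ p q a b (g : ∀ x → x < a → p x ≡ true → ℕ) →
  (∀ x x<a px → g x x<a px < b) → (∀ x x<a px → q (g x x<a px) ≡ true) →
  (∀ x y x<a y<a px py → g x x<a px ≡ g y y<a py → x ≡ y) →
  count p a ≤ count q b
count-≤-injection p q zero    b g g<b qg g-inj = z≤n
count-≤-injection p q (suc a) b g g<b qg g-inj with p a in pa
... | false = subst (_≤ count q b) (sym (+-identityʳ _))
  (count-≤-injection p q a b (λ x x<a → g x (m<n⇒m<1+n x<a))
    (λ x _ → g<b x _) (λ x _ → qg x _) (λ x y _ _ → g-inj x y _ _))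
... | true = subst₂ _≤_ (+-comm 1 (count p a)) (sym (count-erase q b y₀ (g<b a (n<1+n a) pa) (qg a (n<1+n a) pa)))
  (s≤s (count-≤-injection p (erase q y₀) a b (λ x x<a → g x (m<n⇒m<1+n x<a))
    (λ x _ → g<b x _) erase-q-g (λ x y _ _ → g-inj x y _ _)))
  where
  y₀ = g a (n<1+n a) pa
  erase-q-g : ∀ x (x<a : x < a) px → erase q y₀ (g x (m<n⇒m<1+n x<a) px) ≡ true
  erase-q-g x x<a px = erase-≢ q (λ gx≡y₀ → <⇒≢ x<a (g-inj x a _ _ px pa gx≡y₀)) ⟨ trans ⟩ qg x _ px

count-≤-surjection : ∀ p q a b (h : ℕ → ℕ) →
  (∀ x → x < a → p x ≡ true → ∃ λ y → y < b × q y ≡ true × h y ≡ x) →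
  count p a ≤ count q b
count-≤-surjection p q a b h h-onto = count-≤-injection p q a b
  (λ x x<a px → proj₁ (h-onto x x<a px))
  (λ x x<a px → proj₁ (proj₂ (h-onto x x<a px)))
  (λ x x<a px → proj₁ (proj₂ (proj₂ (h-onto x x<a px))))
  (λ x y x<a y<a px py gx≡gy → trans (sym (proj₂ (proj₂ (proj₂ (h-onto x x<a px)))))
     (trans (cong h gx≡gy) (proj₂ (proj₂ (proj₂ (h-onto y y<a py))))))

count-≥-injection : ∀ q r b (g : ℕ → ℕ) → (∀ x → x < r → g x < b) → (∀ x → x < r → q (g x) ≡ true) →
  (∀ x y → x < r → y < r → g x ≡ g y → x ≡ y) → r ≤ count q b
count-≥-injection q r b g g<b qg g-inj = subst (_≤ count q b) (count-true r)
  (count-≤-injection (λ _ → true) q r b (λ x _ _ → g x) (λ x x<r _ → g<b x x<r) (λ x x<r _ → qg x x<r)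
    (λ x y x<r y<r _ _ → g-inj x y x<r y<r))

count+2≤ : ∀ q a x y → x < a → y < a → x ≢ y → q x ≡ false → q y ≡ false → count q a + 2 ≤ a
count+2≤ q a x y x<a y<a x≢y qx qy = subst (count q a + 2 ≤_) (count+count-not q a)
  (+-monoʳ-≤ (count q a) (count-≥-injection (not ∘ q) 2 a pick pick<a not-q-pick pick-injective))
  where
  pick : ℕ → ℕ
  pick zero    = x
  pick (suc _) = y
  pick<a : ∀ i → i < 2 → pick i < a
  pick<a zero    _ = x<a
  pick<a (suc _) _ = y<a
  not-q-pick : ∀ i → i < 2 → not (q (pick i)) ≡ true
  not-q-pick zero    _ = cong not qx
  not-q-pick (suc _) _ = cong not qy
  pick-injective : ∀ i j → i < 2 → j < 2 → pick i ≡ pick j → i ≡ j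
  pick-injective zero       zero       _ _ _ = refl
  pick-injective zero       (suc zero) _ _ e = ⊥-elim (x≢y e)
  pick-injective (suc zero) zero       _ _ e = ⊥-elim (x≢y (sym e))
  pick-injective (suc zero) (suc zero) _ _ _ = refl
  pick-injective (suc (suc _)) _ (s≤s (s≤s ())) _ _
  pick-injective _ (suc (suc _)) _ (s≤s (s≤s ())) _

liftℕ : ∀ {n} → (Fin n → Bool) → ℕ → Bool
liftℕ {zero}  f j       = false
liftℕ {suc n} f zero    = f fzero
liftℕ {suc n} f (suc j) = liftℕ (f ∘ fsuc) j

liftℕ-toℕ : ∀ {n} (f : Fin n → Bool) x → liftℕ f (toℕ x) ≡ f x
liftℕ-toℕ {suc n} f fzero    = refl
liftℕ-toℕ {suc n} f (fsuc x) = liftℕ-toℕ (f ∘ fsuc) x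

liftℕ-fromℕ< : ∀ {n} (f : Fin n → Bool) j (j<n : j < n) → liftℕ f j ≡ f (fromℕ< j<n)
liftℕ-fromℕ< f j j<n = cong (liftℕ f) (sym (Finₚ.toℕ-fromℕ< j<n)) ⟨ trans ⟩ liftℕ-toℕ f (fromℕ< j<n)

countᶠ : ∀ {n} → (Fin n → Bool) → ℕ
countᶠ {n} f = count (liftℕ f) n

∣tabulate∣≡countᶠ : ∀ {n} (f : Fin n → Bool) → ∣ tabulate f ∣ ≡ countᶠ f
∣tabulate∣≡countᶠ {zero}  f = refl
∣tabulate∣≡countᶠ {suc n} f with f fzero in f0
... | true  = cong suc (∣tabulate∣≡countᶠ (f ∘ fsuc))
  ⟨ trans ⟩ sym (count-shift (liftℕ f) n ⟨ trans ⟩ cong (λ b → indicator b + countᶠ (f ∘ fsuc)) f0)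
... | false = ∣tabulate∣≡countᶠ (f ∘ fsuc)
  ⟨ trans ⟩ sym (count-shift (liftℕ f) n ⟨ trans ⟩ cong (λ b → indicator b + countᶠ (f ∘ fsuc)) f0)

countᶠ-true : ∀ n → countᶠ {n} (λ _ → true) ≡ n
countᶠ-true n = count-cong _ _ n (λ j j<n → liftℕ-fromℕ< (λ _ → true) j j<n) ⟨ trans ⟩ count-true n

countᶠ-≤-surjection : ∀ {n} (f : Fin n → Bool) q a (g : ℕ → Fin n) →
  (∀ y → f y ≡ true → ∃ λ j → j < a × q j ≡ true × g j ≡ y) → countᶠ f ≤ count q a
countᶠ-≤-surjection {n} f q a g g-onto = count-≤-surjection (liftℕ f) q n a (toℕ ∘ g) onto
  where
  onto : ∀ x → x < n → liftℕ f x ≡ true → ∃ λ j → j < a × q j ≡ true × toℕ (g j) ≡ x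
  onto x x<n fx with g-onto (fromℕ< x<n) (sym (liftℕ-fromℕ< f x x<n) ⟨ trans ⟩ fx)
  ... | j , j<a , qj , gj = j , j<a , qj , (cong toℕ gj ⟨ trans ⟩ Finₚ.toℕ-fromℕ< x<n)

countᶠ-≥-injection : ∀ {n} (f : Fin n → Bool) r (g : ℕ → Fin n) →
  (∀ i → i < r → f (g i) ≡ true) → (∀ i j → i < r → j < r → g i ≡ g j → i ≡ j) → r ≤ countᶠ f
countᶠ-≥-injection {n} f r g fg g-inj = count-≥-injection (liftℕ f) r n (toℕ ∘ g) (λ i _ → Finₚ.toℕ<n (g i))
  (λ i i<r → liftℕ-toℕ f (g i) ⟨ trans ⟩ fg i i<r) (λ i j i<r j<r e → g-inj i j i<r j<r (Finₚ.toℕ-injective e))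

countᶠ+≤ : ∀ {n} (f : Fin n → Bool) r (g : ℕ → Fin n) →
  (∀ i → i < r → f (g i) ≡ false) → (∀ i j → i < r → j < r → g i ≡ g j → i ≡ j) → countᶠ f + r ≤ n
countᶠ+≤ {n} f r g ¬fg g-inj = subst (countᶠ f + r ≤_) (count+count-not (liftℕ f) n)
  (+-monoʳ-≤ (countᶠ f) (subst (r ≤_) (count-cong _ _ n liftℕ-not)
    (countᶠ-≥-injection (not ∘ f) r g (λ i i<r → cong not (¬fg i i<r)) g-inj)))
  where
  liftℕ-not : ∀ j → j < n → liftℕ (not ∘ f) j ≡ not (liftℕ f j)
  liftℕ-not j j<n = liftℕ-fromℕ< (not ∘ f) j j<n ⟨ trans ⟩ cong not (sym (liftℕ-fromℕ< f j j<n))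

∃-missed : ∀ {n} (g : ℕ → Fin n) s → s < n → ∃ λ y → ∀ i → i < s → g i ≢ y
∃-missed {n} g s s<n with Finₚ.any? (λ y → ¬? (anyUpTo? (λ i → g i Finₚ.≟ y) s))
... | yes (y , unhit) = y , λ i i<s gi≡y → unhit (i , i<s , gi≡y)
... | no all-hit = ⊥-elim (<⇒≱ s<n (subst₂ _≤_ (countᶠ-true n) (count-true s)
  (countᶠ-≤-surjection (λ _ → true) (λ _ → true) s g hit)))
  where
  hit : ∀ y → true ≡ true → ∃ λ j → j < s × true ≡ true × g j ≡ y
  hit y _ with anyUpTo? (λ i → g i Finₚ.≟ y) s
  ... | yes (j , j<s , gj) = j , j<s , refl , gj
  ... | no unhit = ⊥-elim (all-hit (y , unhit))

module _ {n} {P : Fin n → Set} (P? : ∀ x → Dec (P x)) where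

  decSubset : Subset n
  decSubset = tabulate (does ∘ P?)

  ∈decSubset⁺ : ∀ {x} → P x → x ∈ decSubset
  ∈decSubset⁺ {x} px = lookup⇒[]= x decSubset (lookup∘tabulate (does ∘ P?) x ⟨ trans ⟩ dec-true (P? x) px)

  does⇒ : ∀ x → does (P? x) ≡ true → P x
  does⇒ x e with P? x
  ... | yes px = px

  ∈decSubset⁻ : ∀ {x} → x ∈ decSubset → P x
  ∈decSubset⁻ {x} x∈ = does⇒ x (sym (lookup∘tabulate (does ∘ P?) x) ⟨ trans ⟩ []=⇒lookup x∈)

  ∣decSubset∣≡ : ∀ r (g : ℕ → Fin n) → (∀ i → i < r → P (g i)) → (∀ i j → i < r → j < r → g i ≡ g j → i ≡ j) →
    (∀ x → P x → ∃ λ i → i < r × g i ≡ x) → ∣ decSubset ∣ ≡ r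
  ∣decSubset∣≡ r g Pg g-inj g-onto = ∣tabulate∣≡countᶠ (does ∘ P?) ⟨ trans ⟩ ≤-antisym
    (subst (countᶠ (does ∘ P?) ≤_) (count-true r) (countᶠ-≤-surjection (does ∘ P?) (λ _ → true) r g onto))
    (countᶠ-≥-injection (does ∘ P?) r g (λ i i<r → dec-true (P? (g i)) (Pg i i<r)) g-inj)
    where
    onto : ∀ y → does (P? y) ≡ true → ∃ λ j → j < r × true ≡ true × g j ≡ y
    onto y Py with g-onto y (does⇒ y Py)
    ... | j , j<r , gj = j , j<r , refl , gj

even : ℕ → Bool
even zero    = true
even (suc k) = not (even k)

even-+ : ∀ a b → even (a + b) ≡ not (even a xor even b)
even-+ zero    b = sym (Boolₚ.not-involutive (even b))
even-+ (suc a) b rewrite even-+ a b with even a | even b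
... | true  | true  = refl
... | true  | false = refl
... | false | true  = refl
... | false | false = refl

even-∸ : ∀ {i j} → j ≤ i → even i ≡ true → even (i ∸ j) ≡ even j
even-∸ {i} {j} j≤i even-i = xnor⇒≡ (even (i ∸ j)) (even j)
  (sym (even-+ (i ∸ j) j) ⟨ trans ⟩ cong even (m∸n+n≡m j≤i) ⟨ trans ⟩ even-i)
  where
  xnor⇒≡ : ∀ x y → not (x xor y) ≡ true → x ≡ y
  xnor⇒≡ true  true  _ = refl
  xnor⇒≡ false false _ = refl
  xnor⇒≡ true  false ()
  xnor⇒≡ false true  ()

even-double : ∀ a → even (a + a) ≡ true
even-double a = even-+ a a ⟨ trans ⟩ cong not (Boolₚ.xor-same (even a))

even⇒double : ∀ s → even s ≡ true → ∃ λ a → s ≡ a + a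
even⇒double zero          _ = 0 , refl
even⇒double (suc zero)    ()
even⇒double (suc (suc s)) e with even⇒double s (sym (Boolₚ.not-involutive (even s)) ⟨ trans ⟩ e)
... | a , s≡a+a = suc a , cong suc (cong suc s≡a+a ⟨ trans ⟩ sym (+-suc a a))

double-cancel-≤ : ∀ x y → x + x ≤ y + y → x ≤ y
double-cancel-≤ x y x+x≤y+y = ≮⇒≥ (λ y<x → <⇒≱ (+-mono-< y<x y<x) x+x≤y+y)

double-injective : ∀ x y → x + x ≡ y + y → x ≡ y
double-injective x y e = ≤-antisym (double-cancel-≤ x y (≤-reflexive e)) (double-cancel-≤ y x (≤-reflexive (sym e)))

suc[m∸1+n]≡m∸n : ∀ {s i} → i < s → suc (s ∸ suc i) ≡ s ∸ i
suc[m∸1+n]≡m∸n {s} {i} i<s = sym (+-∸-assoc 1 i<s)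

m∸1+n<m : ∀ {s i} → i < s → s ∸ suc i < s
m∸1+n<m {s} {i} i<s = subst (_≤ s) (sym (suc[m∸1+n]≡m∸n i<s)) (m∸n≤m s i)

snoc : ∀ {A : Set} → (ℕ → A) → ℕ → A → ℕ → A
snoc v s w j with j <? s
... | yes _ = v j
... | no  _ = w

snoc-< : ∀ {A : Set} (v : ℕ → A) {s} w {j} → j < s → snoc v s w j ≡ v j
snoc-< v {s} w {j} j<s with j <? s
... | yes _   = refl
... | no j≮s = ⊥-elim (j≮s j<s)

snoc-≡ : ∀ {A : Set} (v : ℕ → A) s w → snoc v s w s ≡ w
snoc-≡ v s w with s <? s
... | yes s<s′ = ⊥-elim (<-irrefl refl s<s′)
... | no  _   = refl

snoc-case : ∀ {A : Set} (v : ℕ → A) {s} w {j} → j ≤ s →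
  (j < s × snoc v s w j ≡ v j) ⊎ (j ≡ s × snoc v s w j ≡ w)
snoc-case v {s} w j≤s with m≤n⇒m<n∨m≡n j≤s
... | inj₁ j<s  = inj₁ (j<s , snoc-< v w j<s)
... | inj₂ refl = inj₂ (refl , snoc-≡ v s w)

snoc-injective : ∀ {A : Set} (v : ℕ → A) s w → (∀ i j → i < s → j < s → v i ≡ v j → i ≡ j) →
  (∀ j → j < s → v j ≢ w) → ∀ i j → i ≤ s → j ≤ s → snoc v s w i ≡ snoc v s w j → i ≡ j
snoc-injective v s w v-inj v≢w i j i≤s j≤s e with snoc-case v w i≤s | snoc-case v w j≤s
... | inj₁ (i<s , ei) | inj₁ (j<s , ej) = v-inj i j i<s j<s (sym ei ⟨ trans ⟩ e ⟨ trans ⟩ ej)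
... | inj₁ (i<s , ei) | inj₂ (_ , ej)   = ⊥-elim (v≢w i i<s (sym ei ⟨ trans ⟩ e ⟨ trans ⟩ ej))
... | inj₂ (_ , ei)   | inj₁ (j<s , ej) = ⊥-elim (v≢w j j<s (sym ej ⟨ trans ⟩ sym e ⟨ trans ⟩ ei))
... | inj₂ (i≡s , _)  | inj₂ (j≡s , _)  = i≡s ⟨ trans ⟩ sym j≡s

flipPrefix : ℕ → ℕ → ℕ
flipPrefix i j with j ≤? i
... | yes _ = i ∸ j
... | no  _ = j

flipPrefix-case : ∀ i j → (j ≤ i × flipPrefix i j ≡ i ∸ j) ⊎ (i < j × flipPrefix i j ≡ j)
flipPrefix-case i j with j ≤? i
... | yes j≤i = inj₁ (j≤i , refl)
... | no  j≰i = inj₂ (≰⇒> j≰i , refl)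

flipPrefix-≤ : ∀ {i j} → j ≤ i → flipPrefix i j ≡ i ∸ j
flipPrefix-≤ {i} {j} j≤i with flipPrefix-case i j
... | inj₁ (_ , e)   = e
... | inj₂ (i<j , _) = ⊥-elim (<⇒≱ i<j j≤i)

flipPrefix-> : ∀ {i j} → i < j → flipPrefix i j ≡ j
flipPrefix-> {i} {j} i<j with flipPrefix-case i j
... | inj₁ (j≤i , _) = ⊥-elim (<⇒≱ i<j j≤i)
... | inj₂ (_ , e)   = e

flipPrefix-≤-bound : ∀ {s i j} → i < s → j ≤ s → flipPrefix i j ≤ s
flipPrefix-≤-bound {s} {i} {j} i<s j≤s with flipPrefix-case i j
... | inj₁ (_ , e) = subst (_≤ s) (sym e) (≤-trans (m∸n≤m i j) (<⇒≤ i<s))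
... | inj₂ (_ , e) = subst (_≤ s) (sym e) j≤s

flipPrefix-injective : ∀ i {a b} → flipPrefix i a ≡ flipPrefix i b → a ≡ b
flipPrefix-injective i {a} {b} e with flipPrefix-case i a | flipPrefix-case i b
... | inj₁ (a≤i , ea) | inj₁ (b≤i , eb) = ∸-cancelˡ-≡ a≤i b≤i (sym ea ⟨ trans ⟩ e ⟨ trans ⟩ eb)
... | inj₁ (_ , ea)   | inj₂ (i<b , eb) = ⊥-elim (<⇒≱ i<b (subst (_≤ i) (sym ea ⟨ trans ⟩ e ⟨ trans ⟩ eb) (m∸n≤m i a)))
... | inj₂ (i<a , ea) | inj₁ (_ , eb)   = ⊥-elim (<⇒≱ i<a (subst (_≤ i) (sym eb ⟨ trans ⟩ sym e ⟨ trans ⟩ ea) (m∸n≤m i b)))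
... | inj₂ (_ , ea)   | inj₂ (_ , eb)   = sym ea ⟨ trans ⟩ e ⟨ trans ⟩ eb

flipPrefix-even : ∀ {i} j → even i ≡ true → even (flipPrefix i j) ≡ even j
flipPrefix-even {i} j even-i with flipPrefix-case i j
... | inj₁ (j≤i , e) = cong even e ⟨ trans ⟩ even-∸ j≤i even-i
... | inj₂ (_ , e)   = cong even e

flipPrefixCol : ∀ {A : Set} → (ℕ → A) → A → ℕ → ℕ → A
flipPrefixCol c f i j with <-cmp j i
... | tri< _ _ _ = c (i ∸ suc j)
... | tri≈ _ _ _ = f
... | tri> _ _ _ = c j

data FlipPrefixCol {A : Set} (c : ℕ → A) (f : A) (i j : ℕ) (r : A) : Set where
  before : j < i → r ≡ c (i ∸ suc j) → FlipPrefixCol c f i j r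
  pivot  : j ≡ i → r ≡ f             → FlipPrefixCol c f i j r
  after  : i < j → r ≡ c j           → FlipPrefixCol c f i j r

flipPrefixCol-view : ∀ {A : Set} (c : ℕ → A) f i j → FlipPrefixCol c f i j (flipPrefixCol c f i j)
flipPrefixCol-view c f i j with <-cmp j i
... | tri< j<i _ _ = before j<i refl
... | tri≈ _ j≡i _ = pivot j≡i refl
... | tri> _ _ i<j = after i<j refl

σ₂-gap : ∀ {k n} → n ∸ 2 ≤ k → k + 3 ≤ n → ⊥
σ₂-gap {k} {n} n∸2≤k k+3≤n = <-irrefl refl
  (≤-trans (subst (_≤ n) (+-comm k 3) k+3≤n) (≤-trans (m≤n+m∸n n 2) (+-monoʳ-≤ 2 n∸2≤k)))

+3≤-on-path : ∀ a b s n → a + 2 ≤ suc s → b + suc (suc s) ≤ n → a + b + 3 ≤ n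
+3≤-on-path a b s n a+2≤ b+2+s≤ = +-cancelˡ-≤ (suc s) _ _
  (subst (_≤ suc s + n) eq (+-mono-≤ a+2≤ b+2+s≤))
  where
  eq : (a + 2) + (b + suc (suc s)) ≡ suc s + (a + b + 3)
  eq = solve 3 (λ a b s → (a :+ con 2) :+ (b :+ (con 2 :+ s)) := (con 1 :+ s) :+ ((a :+ b) :+ con 3)) refl a b s

+3≤-off-path : ∀ a b s n → a ≤ s → b + suc (suc (suc s)) ≤ n → b + a + 3 ≤ n
+3≤-off-path a b s n a≤s b+3+s≤ = +-cancelˡ-≤ s _ _ (subst (_≤ s + n) eq (+-mono-≤ a≤s b+3+s≤))
  where
  eq : a + (b + suc (suc (suc s))) ≡ s + (b + a + 3)
  eq = solve 3 (λ a b s → a :+ (b :+ (con 3 :+ s)) := s :+ ((b :+ a) :+ con 3)) refl a b s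

module RainbowPaths {m n} (G : Collection m n) where

  Adj : Fin m → Fin n → Fin n → Set
  Adj c x y = Edge (G c) x y

  Adj? : ∀ c x y → Dec (Adj c x y)
  Adj? c x y = adj (G c) x y Boolₚ.≟ true

  Adj-sym : ∀ c x y → Adj c x y → Adj c y x
  Adj-sym c x y e = adj-sym (G c) y x ⟨ trans ⟩ e

  Adj⇒≢ : ∀ c x y → Adj c x y → x ≢ y
  Adj⇒≢ c x y e refl with sym e ⟨ trans ⟩ adj-irrefl (G c) x
  ... | ()

  ¬Adj⇒false : ∀ c x y → ¬ Adj c x y → adj (G c) x y ≡ false
  ¬Adj⇒false c x y = Boolₚ.¬-not

  -- A path with s edges: vertices vert 0, …, vert s, edge i from vert i to vert (suc i) in
  -- colour col i.  The values of vert and col outside these ranges are irrelevant.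
  record RainbowPath (s : ℕ) : Set where
    field
      vert           : ℕ → Fin n
      col            : ℕ → Fin m
      vert-injective : ∀ i j → i ≤ s → j ≤ s → vert i ≡ vert j → i ≡ j
      col-injective  : ∀ i j → i < s → j < s → col i ≡ col j → i ≡ j
      edge           : ∀ i → i < s → Adj (col i) (vert i) (vert (suc i))
  open RainbowPath public

  Free : ∀ {s} → RainbowPath s → Fin m → Set
  Free {s} P c = ∀ i → i < s → col P i ≢ c

  OnPath : ∀ {s} → RainbowPath s → Fin n → Set
  OnPath {s} P x = ∃ λ j → j ≤ s × vert P j ≡ x

  OnPath? : ∀ {s} (P : RainbowPath s) x → Dec (OnPath P x)
  OnPath? {s} P x with anyUpTo? (λ j → vert P j Finₚ.≟ x) (suc s)
  ... | yes (j , j<1+s , e) = yes (j , m<1+n⇒m≤n j<1+s , e)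
  ... | no ¬on = no (λ (j , j≤s , e) → ¬on (j , s≤s j≤s , e))

  OnOddPosition : ∀ {s} → RainbowPath s → Fin n → Set
  OnOddPosition {s} P x = ∃ λ j → j ≤ s × even j ≡ false × vert P j ≡ x

  OnOddPosition? : ∀ {s} (P : RainbowPath s) x → Dec (OnOddPosition P x)
  OnOddPosition? {s} P x with anyUpTo? (λ j → (even j Boolₚ.≟ false) ×-dec (vert P j Finₚ.≟ x)) (suc s)
  ... | yes (j , j<1+s , odd) = yes (j , m<1+n⇒m≤n j<1+s , odd)
  ... | no ¬odd = no (λ (j , j≤s , odd) → ¬odd (j , s≤s j≤s , odd))

  OnEvenPosition : ∀ {s} → RainbowPath s → Fin n → Set
  OnEvenPosition {s} P x = ∃ λ j → j ≤ s × even j ≡ true × vert P j ≡ x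

  OnEvenPosition? : ∀ {s} (P : RainbowPath s) x → Dec (OnEvenPosition P x)
  OnEvenPosition? {s} P x with anyUpTo? (λ j → (even j Boolₚ.≟ true) ×-dec (vert P j Finₚ.≟ x)) (suc s)
  ... | yes (j , j<1+s , ev) = yes (j , m<1+n⇒m≤n j<1+s , ev)
  ... | no ¬ev = no (λ (j , j≤s , ev) → ¬ev (j , s≤s j≤s , ev))

  ParitySub : ∀ {s} → RainbowPath s → RainbowPath s → Set
  ParitySub {s} Q P = ∀ j → j ≤ s → ∃ λ j′ → j′ ≤ s × vert Q j ≡ vert P j′ × even j′ ≡ even j

  ParitySub-odd : ∀ {s} (Q P : RainbowPath s) → ParitySub Q P → ∀ {y} → OnOddPosition Q y → OnOddPosition P y
  ParitySub-odd Q P Q⊆P (j , j≤s , odd-j , e) with Q⊆P j j≤s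
  ... | j′ , j′≤s , e′ , parity = j′ , j′≤s , trans parity odd-j , trans (sym e′) e

  ∉⇒≢ : ∀ {s} (P : RainbowPath s) {x} → ¬ OnPath P x → ∀ j → j ≤ s → vert P j ≢ x
  ∉⇒≢ P x∉P j j≤s e = x∉P (j , j≤s , e)

  reverse : ∀ {s} → RainbowPath s → RainbowPath s
  reverse {s} P = record
    { vert           = λ j → vert P (s ∸ j)
    ; col            = λ j → col P (s ∸ suc j)
    ; vert-injective = λ i j i≤s j≤s e →
        ∸-cancelˡ-≡ i≤s j≤s (vert-injective P _ _ (m∸n≤m s i) (m∸n≤m s j) e)
    ; col-injective  = λ i j i<s j<s e →
        suc-injective (∸-cancelˡ-≡ i<s j<s (col-injective P _ _ (m∸1+n<m i<s) (m∸1+n<m j<s) e))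
    ; edge           = λ i i<s → Adj-sym _ _ _
        (subst (λ k → Adj (col P (s ∸ suc i)) (vert P (s ∸ suc i)) (vert P k))
          (suc[m∸1+n]≡m∸n i<s) (edge P (s ∸ suc i) (m∸1+n<m i<s)))
    }

  reverse-Free : ∀ {s} (P : RainbowPath s) {c} → Free P c → Free (reverse P) c
  reverse-Free {s} P c-free i i<s = c-free (s ∸ suc i) (m∸1+n<m i<s)

  reverse-OnPath : ∀ {s} (P : RainbowPath s) {x} → OnPath (reverse P) x → OnPath P x
  reverse-OnPath {s} P (j , j≤s , e) = s ∸ j , m∸n≤m s j , e

  reverse-ParitySub : ∀ {s} (P : RainbowPath s) → even s ≡ true → ParitySub (reverse P) P
  reverse-ParitySub {s} P even-s j j≤s = s ∸ j , m∸n≤m s j , refl , even-∸ j≤s even-s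

  trivial : Fin n → Fin m → RainbowPath 0
  trivial x c = record
    { vert           = λ _ → x
    ; col            = λ _ → c
    ; vert-injective = λ { zero zero _ _ _ → refl }
    ; col-injective  = λ _ _ ()
    ; edge           = λ _ ()
    }

  extend : ∀ {s} (P : RainbowPath s) w c → ¬ OnPath P w → Free P c → Adj c (vert P s) w → RainbowPath (suc s)
  extend {s} P w c w∉P c-free e = record
    { vert           = snoc (vert P) (suc s) w
    ; col            = snoc (col P) s c
    ; vert-injective = snoc-injective (vert P) (suc s) w
        (λ i j i<1+s j<1+s → vert-injective P i j (m<1+n⇒m≤n i<1+s) (m<1+n⇒m≤n j<1+s))
        (λ j j<1+s → ∉⇒≢ P w∉P j (m<1+n⇒m≤n j<1+s))
    ; col-injective  = λ i j i<1+s j<1+s →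
        snoc-injective (col P) s c (col-injective P) c-free i j (m<1+n⇒m≤n i<1+s) (m<1+n⇒m≤n j<1+s)
    ; edge           = edge′
    }
    where
    edge′ : ∀ i → i < suc s → Adj (snoc (col P) s c i) (snoc (vert P) (suc s) w i) (snoc (vert P) (suc s) w (suc i))
    edge′ i i<1+s with m<1+n⇒m<n∨m≡n i<1+s
    ... | inj₁ i<s rewrite snoc-< (col P) c i<s | snoc-< (vert P) w (m<n⇒m<1+n i<s) | snoc-< (vert P) w (s≤s i<s) =
      edge P i i<s
    ... | inj₂ refl rewrite snoc-≡ (col P) i c | snoc-< (vert P) w (n<1+n i) | snoc-≡ (vert P) (suc i) w = e

  extend-at-start : ∀ {s} (P : RainbowPath s) w c → ¬ OnPath P w → Free P c → Adj c (vert P 0) w → RainbowPath (suc s)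
  extend-at-start {s} P w c w∉P c-free e = extend (reverse P) w c (λ w∈ → w∉P (reverse-OnPath P w∈)) (reverse-Free P c-free)
    (subst (λ k → Adj c (vert P k) w) (sym (n∸n≡0 s)) e)

  path₁-or-edgeless : RainbowPath 1 ⊎ (∀ c x y → adj (G c) x y ≡ false)
  path₁-or-edgeless with Finₚ.any? (λ c → Finₚ.any? (λ x → Finₚ.any? (λ y → Adj? c x y)))
  ... | yes (c , x , y , e) = inj₁ (extend (trivial x c) y c (λ (_ , _ , x≡y) → Adj⇒≢ c x y e x≡y) (λ _ ()) e)
  ... | no  no-edge         = inj₂ λ c x y → ¬Adj⇒false c x y λ e → no-edge (c , x , y , e)

  -- Pósa rotation: the chord f from vert 0 to vert (suc i) turns
  -- vert i, …, vert 0, vert (suc i), …, vert s into a rainbow path, freeing col i.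
  module Rotation {s} (P : RainbowPath s) (i : ℕ) (f : Fin m) (i<s : i < s) (f-free : Free P f)
                  (chord : Adj f (vert P 0) (vert P (suc i))) where

    private
      col′ = flipPrefixCol (col P) f i
      before<s : ∀ {j} → j < i → i ∸ suc j < s
      before<s j<i = <-≤-trans (m∸1+n<m j<i) (<⇒≤ i<s)

    col′-injective : ∀ a b → a < s → b < s → col′ a ≡ col′ b → a ≡ b
    col′-injective a b a<s b<s e with flipPrefixCol-view (col P) f i a | flipPrefixCol-view (col P) f i b
    ... | before a<i ea | before b<i eb =
      suc-injective (∸-cancelˡ-≡ a<i b<i (col-injective P _ _ (before<s a<i) (before<s b<i) (sym ea ⟨ trans ⟩ e ⟨ trans ⟩ eb)))
    ... | before a<i ea | pivot _ eb = ⊥-elim (f-free _ (before<s a<i) (sym ea ⟨ trans ⟩ e ⟨ trans ⟩ eb))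
    ... | before a<i ea | after i<b eb =
      ⊥-elim (<-asym (subst (_< i) (col-injective P _ _ (before<s a<i) b<s (sym ea ⟨ trans ⟩ e ⟨ trans ⟩ eb)) (m∸1+n<m a<i)) i<b)
    ... | pivot _ ea | before b<i eb = ⊥-elim (f-free _ (before<s b<i) (sym eb ⟨ trans ⟩ sym e ⟨ trans ⟩ ea))
    ... | pivot a≡i _ | pivot b≡i _ = a≡i ⟨ trans ⟩ sym b≡i
    ... | pivot _ ea | after _ eb = ⊥-elim (f-free b b<s (sym eb ⟨ trans ⟩ sym e ⟨ trans ⟩ ea))
    ... | after i<a ea | before b<i eb =
      ⊥-elim (<-asym (subst (_< i) (col-injective P _ _ (before<s b<i) a<s (sym eb ⟨ trans ⟩ sym e ⟨ trans ⟩ ea)) (m∸1+n<m b<i)) i<a)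
    ... | after _ ea | pivot _ eb = ⊥-elim (f-free a a<s (sym ea ⟨ trans ⟩ e ⟨ trans ⟩ eb))
    ... | after _ ea | after _ eb = col-injective P a b a<s b<s (sym ea ⟨ trans ⟩ e ⟨ trans ⟩ eb)

    edge′ : ∀ j → j < s → Adj (col′ j) (vert P (flipPrefix i j)) (vert P (flipPrefix i (suc j)))
    edge′ j j<s with flipPrefixCol-view (col P) f i j
    ... | before j<i e rewrite e | flipPrefix-≤ (<⇒≤ j<i) | flipPrefix-≤ j<i = Adj-sym _ _ _
      (subst (λ k → Adj (col P (i ∸ suc j)) (vert P (i ∸ suc j)) (vert P k)) (suc[m∸1+n]≡m∸n j<i)
        (edge P (i ∸ suc j) (before<s j<i)))
    ... | pivot refl e rewrite e | flipPrefix-≤ (≤-refl {j}) | n∸n≡0 j | flipPrefix-> (n<1+n j) = chord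
    ... | after i<j e rewrite e | flipPrefix-> i<j | flipPrefix-> (m<n⇒m<1+n i<j) = edge P j j<s

    rotate : RainbowPath s
    rotate = record
      { vert           = vert P ∘ flipPrefix i
      ; col            = col′
      ; vert-injective = λ a b a≤s b≤s e → flipPrefix-injective i
          (vert-injective P _ _ (flipPrefix-≤-bound i<s a≤s) (flipPrefix-≤-bound i<s b≤s) e)
      ; col-injective  = col′-injective
      ; edge           = edge′
      }

    rotate-start : vert rotate 0 ≡ vert P i
    rotate-start = cong (vert P) (flipPrefix-≤ z≤n)

    rotate-end : vert rotate s ≡ vert P s
    rotate-end = cong (vert P) (flipPrefix-> i<s)

    rotate-frees : Free rotate (col P i)
    rotate-frees a a<s e with flipPrefixCol-view (col P) f i a
    ... | before a<i ea = <⇒≢ (m∸1+n<m a<i) (col-injective P _ _ (before<s a<i) i<s (sym ea ⟨ trans ⟩ e))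
    ... | pivot _ ea    = f-free i i<s (sym e ⟨ trans ⟩ ea)
    ... | after i<a ea  = <⇒≢ i<a (sym (col-injective P _ _ a<s i<s (sym ea ⟨ trans ⟩ e)))

    rotate-Free : ∀ {g} → Free P g → g ≢ f → Free rotate g
    rotate-Free g-free g≢f a a<s e with flipPrefixCol-view (col P) f i a
    ... | before a<i ea = g-free _ (before<s a<i) (sym ea ⟨ trans ⟩ e)
    ... | pivot _ ea    = g≢f (sym e ⟨ trans ⟩ ea)
    ... | after _ ea    = g-free a a<s (sym ea ⟨ trans ⟩ e)

    rotate-OnPath : ∀ {x} → OnPath rotate x → OnPath P x
    rotate-OnPath (j , j≤s , e) = flipPrefix i j , flipPrefix-≤-bound i<s j≤s , e

    rotate-ParitySub : even i ≡ true → ParitySub rotate P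
    rotate-ParitySub even-i j j≤s = flipPrefix i j , flipPrefix-≤-bound i<s j≤s , refl , flipPrefix-even j even-i

  module Recolouring {s} (P : RainbowPath s) (i : ℕ) (f : Fin m) (i<s : i < s) (f-free : Free P f)
                     (f-edge : Adj f (vert P i) (vert P (suc i))) where

    col′ : ℕ → Fin m
    col′ j with j ≟ i
    ... | yes _ = f
    ... | no  _ = col P j

    col′-case : ∀ j → (j ≡ i × col′ j ≡ f) ⊎ (j ≢ i × col′ j ≡ col P j)
    col′-case j with j ≟ i
    ... | yes j≡i = inj₁ (j≡i , refl)
    ... | no  j≢i = inj₂ (j≢i , refl)

    recolour : RainbowPath s
    recolour = record
      { vert           = vert P
      ; col            = col′
      ; vert-injective = vert-injective P
      ; col-injective  = col′-injective
      ; edge           = edge′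
      }
      where
      col′-injective : ∀ a b → a < s → b < s → col′ a ≡ col′ b → a ≡ b
      col′-injective a b a<s b<s e with col′-case a | col′-case b
      ... | inj₁ (a≡i , _)  | inj₁ (b≡i , _)  = a≡i ⟨ trans ⟩ sym b≡i
      ... | inj₁ (_ , ea)   | inj₂ (_ , eb)   = ⊥-elim (f-free b b<s (sym eb ⟨ trans ⟩ sym e ⟨ trans ⟩ ea))
      ... | inj₂ (_ , ea)   | inj₁ (_ , eb)   = ⊥-elim (f-free a a<s (sym ea ⟨ trans ⟩ e ⟨ trans ⟩ eb))
      ... | inj₂ (_ , ea)   | inj₂ (_ , eb)   = col-injective P a b a<s b<s (sym ea ⟨ trans ⟩ e ⟨ trans ⟩ eb)
      edge′ : ∀ j → j < s → Adj (col′ j) (vert P j) (vert P (suc j))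
      edge′ j j<s with col′-case j
      ... | inj₁ (refl , e) rewrite e = f-edge
      ... | inj₂ (_ , e)    rewrite e = edge P j j<s

    recolour-frees : Free recolour (col P i)
    recolour-frees a a<s e with col′-case a
    ... | inj₁ (_ , ea)   = f-free i i<s (sym e ⟨ trans ⟩ ea)
    ... | inj₂ (a≢i , ea) = a≢i (col-injective P a i a<s i<s (sym ea ⟨ trans ⟩ e))

    recolour-Free : ∀ {g} → Free P g → g ≢ f → Free recolour g
    recolour-Free g-free g≢f a a<s e with col′-case a
    ... | inj₁ (_ , ea) = g≢f (sym e ⟨ trans ⟩ ea)
    ... | inj₂ (_ , ea) = g-free a a<s (sym ea ⟨ trans ⟩ e)

  record Palette {s} (P : RainbowPath s) : Set where
    constructor palette
    field
      f₁ f₂ f₃ : Fin m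
      f₁≢f₂    : f₁ ≢ f₂
      f₁≢f₃    : f₁ ≢ f₃
      f₂≢f₃    : f₂ ≢ f₃
      f₁-free  : Free P f₁
      f₂-free  : Free P f₂
      f₃-free  : Free P f₃

  module _ {s} {P : RainbowPath s} (F : Palette P) where
    open Palette F

    swap₁₂ : Palette P
    swap₁₂ = palette f₂ f₁ f₃ (f₁≢f₂ ∘ sym) f₂≢f₃ f₁≢f₃ f₂-free f₁-free f₃-free

    roll : Palette P
    roll = palette f₂ f₃ f₁ f₂≢f₃ (f₁≢f₂ ∘ sym) (f₁≢f₃ ∘ sym) f₂-free f₃-free f₁-free

    prepend : ∀ c → Free P c → c ≢ f₁ → c ≢ f₂ → Palette P
    prepend c c-free c≢f₁ c≢f₂ = palette c f₁ f₂ c≢f₁ c≢f₂ f₁≢f₂ c-free f₁-free f₂-free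

    reverse-palette : Palette (reverse P)
    reverse-palette = palette f₁ f₂ f₃ f₁≢f₂ f₁≢f₃ f₂≢f₃
      (reverse-Free P f₁-free) (reverse-Free P f₂-free) (reverse-Free P f₃-free)

    rotate-palette : ∀ {i} (i<s : i < s) (chord : Adj f₁ (vert P 0) (vert P (suc i))) →
      Palette (Rotation.rotate P i f₁ i<s f₁-free chord)
    rotate-palette {i} i<s chord = palette f₂ f₃ (col P i) f₂≢f₃ (λ e → f₂-free i i<s (sym e)) (λ e → f₃-free i i<s (sym e))
      (rotate-Free f₂-free (f₁≢f₂ ∘ sym)) (rotate-Free f₃-free (f₁≢f₃ ∘ sym)) rotate-frees
      where open Rotation P i f₁ i<s f₁-free chord

    recolour-palette : ∀ {i} (i<s : i < s) (f₂-edge : Adj f₂ (vert P i) (vert P (suc i))) →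
      Palette (Recolouring.recolour P i f₂ i<s f₂-free f₂-edge)
    recolour-palette {i} i<s f₂-edge = palette (col P i) f₁ f₃ (λ e → f₁-free i i<s e) (λ e → f₃-free i i<s e) f₁≢f₃
      recolour-frees (recolour-Free f₁-free f₁≢f₂) (recolour-Free f₃-free (f₂≢f₃ ∘ sym))
      where open Recolouring P i f₂ i<s f₂-free f₂-edge

  ∃palette : ∀ {s} (P : RainbowPath s) → 3 + s ≤ m → Palette P
  ∃palette {s} P 3+s≤m with ∃-missed (col P) s (≤-trans (n≤1+n _) (≤-trans (n≤1+n _) 3+s≤m))
  ... | c₁ , c₁-free with ∃-missed (snoc (col P) s c₁) (suc s) (≤-trans (n≤1+n _) 3+s≤m)
  ... | c₂ , c₂-new with ∃-missed (snoc (snoc (col P) s c₁) (suc s) c₂) (suc (suc s)) 3+s≤m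
  ... | c₃ , c₃-new = palette c₁ c₂ c₃
    (λ e → c₂-new s (n<1+n s) (snoc-≡ (col P) s c₁ ⟨ trans ⟩ e))
    (λ e → c₃-new s (<-trans (n<1+n s) (n<1+n (suc s))) (old (n<1+n s) ⟨ trans ⟩ snoc-≡ (col P) s c₁ ⟨ trans ⟩ e))
    (λ e → c₃-new (suc s) (n<1+n (suc s)) (snoc-≡ (snoc (col P) s c₁) (suc s) c₂ ⟨ trans ⟩ e))
    c₁-free
    (λ i i<s e → c₂-new i (m<n⇒m<1+n i<s) (snoc-< (col P) c₁ i<s ⟨ trans ⟩ e))
    (λ i i<s e → c₃-new i (m<n⇒m<1+n (m<n⇒m<1+n i<s)) (old (m<n⇒m<1+n i<s) ⟨ trans ⟩ snoc-< (col P) c₁ i<s ⟨ trans ⟩ e))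
    where
    old : ∀ {i} → i < suc s → snoc (snoc (col P) s c₁) (suc s) c₂ i ≡ snoc (col P) s c₁ i
    old = snoc-< (snoc (col P) s c₁) c₂

  record RainbowCycle (s : ℕ) : Set where
    constructor cycle
    field
      path         : RainbowPath s
      closing      : Fin m
      closing-free : Free path closing
      closing-edge : Adj closing (vert path s) (vert path 0)
  open RainbowCycle public

  Spare : ∀ {s} → RainbowCycle s → Fin m → Set
  Spare C f = Free (path C) f × f ≢ closing C

  -- Moves the first vertex of the cycle to the end.
  shift : ∀ {s} → RainbowCycle s → RainbowCycle s
  shift {zero}  C = ⊥-elim (Adj⇒≢ _ _ _ (closing-edge C) refl)
  shift {suc t} (cycle P d d-free closing) = cycle P′ (col P 0) col₀-free closing′
    where
    vert′-injective : ∀ a b → a ≤ suc t → b ≤ suc t → vert P (snoc suc (suc t) 0 a) ≡ vert P (snoc suc (suc t) 0 b) → a ≡ b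
    vert′-injective a b a≤ b≤ e = snoc-injective suc (suc t) 0 (λ i j _ _ → suc-injective) (λ _ _ ()) a b a≤ b≤
      (vert-injective P _ _ (index≤ a a≤) (index≤ b b≤) e)
      where
      index≤ : ∀ a → a ≤ suc t → snoc suc (suc t) 0 a ≤ suc t
      index≤ a a≤ with snoc-case suc 0 a≤
      ... | inj₁ (a<1+t , e) = subst (_≤ suc t) (sym e) a<1+t
      ... | inj₂ (_ , e)     = subst (_≤ suc t) (sym e) z≤n
    col′-injective : ∀ a b → a < suc t → b < suc t → snoc (col P ∘ suc) t d a ≡ snoc (col P ∘ suc) t d b → a ≡ b
    col′-injective a b a<1+t b<1+t = snoc-injective (col P ∘ suc) t d
      (λ i j i<t j<t e → suc-injective (col-injective P _ _ (s≤s i<t) (s≤s j<t) e))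
      (λ j j<t → d-free (suc j) (s≤s j<t)) a b (m<1+n⇒m≤n a<1+t) (m<1+n⇒m≤n b<1+t)
    edge′ : ∀ j → j < suc t → Adj (snoc (col P ∘ suc) t d j) (vert P (snoc suc (suc t) 0 j)) (vert P (snoc suc (suc t) 0 (suc j)))
    edge′ j j<1+t with m<1+n⇒m<n∨m≡n j<1+t
    ... | inj₁ j<t rewrite snoc-< (col P ∘ suc) d j<t | snoc-< suc 0 j<1+t | snoc-< suc 0 (s≤s j<t) = edge P (suc j) (s≤s j<t)
    ... | inj₂ refl rewrite snoc-≡ (col P ∘ suc) j d | snoc-< suc 0 j<1+t | snoc-≡ suc (suc j) 0 = closing
    P′ : RainbowPath (suc t)
    P′ = record
      { vert           = vert P ∘ snoc suc (suc t) 0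
      ; col            = snoc (col P ∘ suc) t d
      ; vert-injective = vert′-injective
      ; col-injective  = col′-injective
      ; edge           = edge′
      }
    col₀-free : Free P′ (col P 0)
    col₀-free a a<1+t e with snoc-case (col P ∘ suc) d (m<1+n⇒m≤n a<1+t)
    ... | inj₁ (a<t , ea) with col-injective P _ _ (s≤s a<t) (s≤s z≤n) (sym ea ⟨ trans ⟩ e)
    ... | ()
    col₀-free a a<1+t e | inj₂ (_ , ea) = d-free 0 (s≤s z≤n) (sym e ⟨ trans ⟩ ea)
    closing′ : Adj (col P 0) (vert P (snoc suc (suc t) 0 (suc t))) (vert P (snoc suc (suc t) 0 0))
    closing′ rewrite snoc-≡ suc (suc t) 0 | snoc-< suc 0 (s≤s (z≤n {t})) = edge P 0 (s≤s z≤n)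

  shift-vert : ∀ {s} (C : RainbowCycle s) r → r < s → vert (path (shift C)) r ≡ vert (path C) (suc r)
  shift-vert {suc t} (cycle P _ _ _) r r<s = cong (vert P) (snoc-< suc 0 r<s)

  shift-last : ∀ {s} (C : RainbowCycle s) → vert (path (shift C)) s ≡ vert (path C) 0
  shift-last {zero}  C = ⊥-elim (Adj⇒≢ _ _ _ (closing-edge C) refl)
  shift-last {suc t} (cycle P _ _ _) = cong (vert P) (snoc-≡ suc (suc t) 0)

  shift-OnPath : ∀ {s} (C : RainbowCycle s) {x} → OnPath (path (shift C)) x → OnPath (path C) x
  shift-OnPath {zero}  C _ = ⊥-elim (Adj⇒≢ _ _ _ (closing-edge C) refl)
  shift-OnPath {suc t} (cycle P _ _ _) (j , j≤s , e) = snoc suc (suc t) 0 j , index≤ , e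
    where
    index≤ : snoc suc (suc t) 0 j ≤ suc t
    index≤ with snoc-case suc 0 j≤s
    ... | inj₁ (j<s , e′) = subst (_≤ suc t) (sym e′) j<s
    ... | inj₂ (_ , e′)   = subst (_≤ suc t) (sym e′) z≤n

  shift-Spare : ∀ {s} (C : RainbowCycle s) {f} → Spare C f → Spare (shift C) f
  shift-Spare {zero}  C _ = ⊥-elim (Adj⇒≢ _ _ _ (closing-edge C) refl)
  shift-Spare {suc t} (cycle P d d-free closing) {f} (f-free , f≢d) = f-free′ , λ f≡c₀ → f-free 0 (s≤s z≤n) (sym f≡c₀)
    where
    f-free′ : Free (path (shift (cycle P d d-free closing))) f
    f-free′ a a<s e with snoc-case (col P ∘ suc) d (m<1+n⇒m≤n a<s)
    ... | inj₁ (a<t , ea) = f-free (suc a) (s≤s a<t) (sym ea ⟨ trans ⟩ e)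
    ... | inj₂ (_ , ea)   = f≢d (sym e ⟨ trans ⟩ ea)

  shift-until : ∀ {s} r (C : RainbowCycle s) → r ≤ s → Σ (RainbowCycle s) λ C′ →
    (∀ {x} → OnPath (path C′) x → OnPath (path C) x) × (∀ {f} → Spare C f → Spare C′ f) ×
    vert (path C′) s ≡ vert (path C) r
  shift-until zero    C _     = shift C , shift-OnPath C , shift-Spare C , shift-last C
  shift-until (suc r) C 1+r≤s with shift-until r (shift C) (≤-trans (n≤1+n r) 1+r≤s)
  ... | C′ , on , spare , last =
    C′ , (λ x∈C′ → shift-OnPath C (on x∈C′)) , (λ f-spare → spare (shift-Spare C f-spare)) ,
    (last ⟨ trans ⟩ shift-vert C r 1+r≤s)

  open-and-extend : ∀ {s} (C : RainbowCycle s) c → Spare C c → ∀ {u y} →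
    OnPath (path C) u → ¬ OnPath (path C) y → Adj c u y → RainbowPath (suc s)
  open-and-extend {s} C c c-spare {u} {y} (r , r≤s , vr≡u) y∉C e with shift-until r C r≤s
  ... | C′ , on , spare , last = extend (path C′) y c (λ y∈C′ → y∉C (on y∈C′)) (proj₁ (spare c-spare))
    (subst (λ x → Adj c x y) (sym (last ⟨ trans ⟩ vr≡u)) e)

  injection⇒≤ : ∀ r (g : ℕ → Fin n) → (∀ i j → i < r → j < r → g i ≡ g j → i ≡ j) → r ≤ n
  injection⇒≤ r g g-inj = subst (r ≤_) (countᶠ-true n) (countᶠ-≥-injection (λ _ → true) r g (λ _ _ → refl) g-inj)

  module _ {s} (P : RainbowPath s) where

    vert-injective< : ∀ i j → i < suc s → j < suc s → vert P i ≡ vert P j → i ≡ j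
    vert-injective< i j i<1+s j<1+s = vert-injective P i j (m<1+n⇒m≤n i<1+s) (m<1+n⇒m≤n j<1+s)

    vert+ : Fin n → ℕ → Fin n
    vert+ x = snoc (vert P) (suc s) x

    vert+-injective : ∀ {x} → ¬ OnPath P x → ∀ i j → i < 2 + s → j < 2 + s → vert+ x i ≡ vert+ x j → i ≡ j
    vert+-injective {x} x∉P i j i<2+s j<2+s = snoc-injective (vert P) (suc s) x vert-injective<
      (λ j j<1+s → ∉⇒≢ P x∉P j (m<1+n⇒m≤n j<1+s)) i j (m<1+n⇒m≤n i<2+s) (m<1+n⇒m≤n j<2+s)

    vert++ : Fin n → Fin n → ℕ → Fin n
    vert++ x y = snoc (vert+ x) (2 + s) y

    vert++-injective : ∀ {x y} → ¬ OnPath P x → ¬ OnPath P y → x ≢ y →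
      ∀ i j → i < 3 + s → j < 3 + s → vert++ x y i ≡ vert++ x y j → i ≡ j
    vert++-injective {x} {y} x∉P y∉P x≢y i j i<3+s j<3+s =
      snoc-injective (vert+ x) (2 + s) y (vert+-injective x∉P) y-fresh i j (m<1+n⇒m≤n i<3+s) (m<1+n⇒m≤n j<3+s)
      where
      y-fresh : ∀ j → j < 2 + s → vert+ x j ≢ y
      y-fresh j j<2+s with snoc-case (vert P) x (m<1+n⇒m≤n j<2+s)
      ... | inj₁ (j<1+s , e) = λ e′ → ∉⇒≢ P y∉P j (m<1+n⇒m≤n j<1+s) (sym e ⟨ trans ⟩ e′)
      ... | inj₂ (_ , e)     = λ e′ → x≢y (sym e ⟨ trans ⟩ e′)

    offPath⇒+2≤ : ∀ {x} → ¬ OnPath P x → s + 2 ≤ n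
    offPath⇒+2≤ {x} x∉P = subst (_≤ n) (+-comm 2 s) (injection⇒≤ (2 + s) (vert+ x) (vert+-injective x∉P))

    offPath-unique : s + 2 ≡ n → ∀ {x y} → ¬ OnPath P x → ¬ OnPath P y → x ≡ y
    offPath-unique s+2≡n {x} {y} x∉P y∉P with x Finₚ.≟ y
    ... | yes x≡y = x≡y
    ... | no  x≢y = ⊥-elim (<-irrefl refl (subst₂ _≤_ (cong suc (+-comm 2 s)) (sym s+2≡n)
      (injection⇒≤ (3 + s) (vert++ x y) (vert++-injective x∉P y∉P x≢y))))

    ∃offPath : s + 2 ≤ n → ∃ λ w → ¬ OnPath P w
    ∃offPath s+2≤n with ∃-missed (vert P) (suc s) (subst (_≤ n) (+-comm s 2) s+2≤n)
    ... | w , unhit = w , λ (j , j≤s , e) → unhit j (s≤s j≤s) e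

    OnPath-all : suc s ≡ n → ∀ x → OnPath P x
    OnPath-all 1+s≡n x with OnPath? P x
    ... | yes x∈P = x∈P
    ... | no  x∉P = ⊥-elim (<-irrefl refl (subst₂ _≤_ (+-comm s 2) (sym 1+s≡n) (offPath⇒+2≤ x∉P)))

hamiltonian : ∀ {m n} (G : Collection m n) {s} (P : RainbowPaths.RainbowPath G s) → suc s ≡ n → RainbowHamPath G
hamiltonian G {s} P refl = v , c , v-injective , v-surjective , c-injective , c-edge
  where
  open RainbowPaths G
  v : Fin (suc s) → Fin (suc s)
  v = vert P ∘ toℕ
  c : Fin s → _
  c = col P ∘ toℕ
  v-injective : ∀ {x y} → v x ≡ v y → x ≡ y
  v-injective {x} {y} e = Finₚ.toℕ-injective (vert-injective< P _ _ (Finₚ.toℕ<n x) (Finₚ.toℕ<n y) e)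
  v-surjective : ∀ x → ∃ λ i → v i ≡ x
  v-surjective x with OnPath-all P refl x
  ... | j , j≤s , e = fromℕ< (s≤s j≤s) , (cong (vert P) (Finₚ.toℕ-fromℕ< (s≤s j≤s)) ⟨ trans ⟩ e)
  c-injective : ∀ {i j} → c i ≡ c j → i ≡ j
  c-injective {i} {j} e = Finₚ.toℕ-injective (col-injective P _ _ (Finₚ.toℕ<n i) (Finₚ.toℕ<n j) e)
  c-edge : ∀ i → Edge (G (c i)) (v (inject₁ i)) (v (fsuc i))
  c-edge i = subst (λ k → Adj (col P (toℕ i)) (vert P k) (vert P (suc (toℕ i)))) (sym (Finₚ.toℕ-inject₁ i))
    (edge P (toℕ i) (Finₚ.toℕ<n i))

module Extension {m n} (G : Collection m n) (σ₂-G : ∀ c → σ₂≥ (G c) (n ∸ 2)) where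

  open RainbowPaths G

  Progress : ℕ → Set
  Progress s = RainbowPath (suc s) ⊎ (TwoCliques G ⊎ BigIndependent G)

  ProgressOr : ℕ → Set → Set
  ProgressOr s X = Progress s ⊎ X

  _>>=_ : ∀ {s} {X Y : Set} → ProgressOr s X → (X → ProgressOr s Y) → ProgressOr s Y
  inj₁ p >>= _ = inj₁ p
  inj₂ x >>= k = k x

  longer : ∀ {s} {X : Set} → RainbowPath (suc s) → ProgressOr s X
  longer P = inj₁ (inj₁ P)

  degree : Fin m → Fin n → ℕ
  degree c x = countᶠ (adj (G c) x)

  σ₂-bound : ∀ c x y → x ≢ y → ¬ Adj c x y → n ∸ 2 ≤ degree c x + degree c y
  σ₂-bound c x y x≢y ¬e = subst (n ∸ 2 ≤_) (cong₂ _+_ (∣tabulate∣≡countᶠ (adj (G c) x)) (∣tabulate∣≡countᶠ (adj (G c) y)))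
    (σ₂-G c x y x≢y (¬Adj⇒false c x y ¬e))

  Crossing : ∀ {s} → RainbowPath s → Fin m → Set
  Crossing P c = ∃ λ u → ∃ λ y → OnPath P u × ¬ OnPath P y × Adj c u y

  Crossing? : ∀ {s} (P : RainbowPath s) c → Dec (Crossing P c)
  Crossing? P c = Finₚ.any? λ u → Finₚ.any? λ y → OnPath? P u ×-dec ¬? (OnPath? P y) ×-dec Adj? c u y

  module NoCrossing {s} (P : RainbowPath s) (s+2≤n : s + 2 ≤ n) (c : Fin m) (no-crossing : ¬ Crossing P c) where

    private
      adjAlong : Fin n → ℕ → Bool
      adjAlong x j = adj (G c) x (vert P j)

      w   = proj₁ (∃offPath P s+2≤n)
      w∉P = proj₂ (∃offPath P s+2≤n)

      off-path-isolated : ∀ {x} → ¬ OnPath P x → ∀ i → i ≤ s → adj (G c) x (vert P i) ≡ false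
      off-path-isolated x∉P i i≤s = ¬Adj⇒false c _ _ λ e → no-crossing (_ , _ , (i , i≤s , refl) , x∉P , Adj-sym c _ _ e)

    degree≤ : ∀ {x} → OnPath P x → degree c x ≤ count (adjAlong x) (suc s)
    degree≤ {x} x∈P = countᶠ-≤-surjection (adj (G c) x) (adjAlong x) (suc s) (vert P) onto
      where
      onto : ∀ y → adj (G c) x y ≡ true → ∃ λ j → j < suc s × adjAlong x j ≡ true × vert P j ≡ y
      onto y e with OnPath? P y
      ... | yes (j , j≤s , vj≡y) = j , s≤s j≤s , (cong (adj (G c) x) vj≡y ⟨ trans ⟩ e) , vj≡y
      ... | no  y∉P = ⊥-elim (no-crossing (x , y , x∈P , y∉P , e))

    -- x misses itself and y on P, w misses P and itself, so deg x + deg w ≤ n − 3 < σ₂.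
    complete-on-path : ∀ {x y} → OnPath P x → OnPath P y → x ≢ y → Adj c x y
    complete-on-path {x} {y} x∈P@(i , i≤s , vi≡x) (j , j≤s , vj≡y) x≢y with Adj? c x y
    ... | yes e  = e
    ... | no  ¬e = ⊥-elim (σ₂-gap (σ₂-bound c x w x≢w λ e → no-crossing (x , w , x∈P , w∉P , e))
      (+3≤-on-path (degree c x) (degree c w) s n (≤-trans (+-monoˡ-≤ 2 (degree≤ x∈P)) x-degree) w-degree))
      where
      x≢w : x ≢ w
      x≢w x≡w = w∉P (subst (OnPath P) x≡w x∈P)
      x-degree : count (adjAlong x) (suc s) + 2 ≤ suc s
      x-degree = count+2≤ (adjAlong x) (suc s) i j (s≤s i≤s) (s≤s j≤s)
        (λ i≡j → x≢y (sym vi≡x ⟨ trans ⟩ cong (vert P) i≡j ⟨ trans ⟩ vj≡y))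
        (cong (adj (G c) x) vi≡x ⟨ trans ⟩ adj-irrefl (G c) x) (cong (adj (G c) x) vj≡y ⟨ trans ⟩ ¬Adj⇒false c x y ¬e)
      w-degree : degree c w + suc (suc s) ≤ n
      w-degree = countᶠ+≤ (adj (G c) w) (2 + s) (vert+ P w) isolated (vert+-injective P w∉P)
        where
        isolated : ∀ i → i < 2 + s → adj (G c) w (vert+ P w i) ≡ false
        isolated i i<2+s with snoc-case (vert P) w (m<1+n⇒m≤n i<2+s)
        ... | inj₁ (i<1+s , e) = cong (adj (G c) w) e ⟨ trans ⟩ off-path-isolated w∉P i (m<1+n⇒m≤n i<1+s)
        ... | inj₂ (_ , e)     = cong (adj (G c) w) e ⟨ trans ⟩ adj-irrefl (G c) w

    -- v₀ sees at most s vertices of P, x misses P, itself and y, so deg x + deg v₀ ≤ n − 3 < σ₂.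
    complete-off-path : ∀ {x y} → ¬ OnPath P x → ¬ OnPath P y → x ≢ y → Adj c x y
    complete-off-path {x} {y} x∉P y∉P x≢y with Adj? c x y
    ... | yes e  = e
    ... | no  ¬e = ⊥-elim (σ₂-gap (σ₂-bound c x (vert P 0) x≢v₀ λ e → no-crossing (_ , x , v₀∈P , x∉P , Adj-sym c _ _ e))
      (+3≤-off-path (degree c (vert P 0)) (degree c x) s n v₀-degree x-degree))
      where
      v₀∈P : OnPath P (vert P 0)
      v₀∈P = 0 , z≤n , refl
      x≢v₀ : x ≢ vert P 0
      x≢v₀ x≡v₀ = x∉P (subst (OnPath P) (sym x≡v₀) v₀∈P)
      v₀-degree : degree c (vert P 0) ≤ s
      v₀-degree = ≤-trans (degree≤ v₀∈P) (≤-pred (count< (adjAlong (vert P 0)) (suc s) 0 (s≤s z≤n) (adj-irrefl (G c) _)))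
      x-degree : degree c x + suc (suc (suc s)) ≤ n
      x-degree = countᶠ+≤ (adj (G c) x) (3 + s) (vert++ P x y) isolated (vert++-injective P x∉P y∉P x≢y)
        where
        isolated : ∀ i → i < 3 + s → adj (G c) x (vert++ P x y i) ≡ false
        isolated i i<3+s with snoc-case (vert+ P x) y (m<1+n⇒m≤n i<3+s)
        ... | inj₂ (_ , e) = cong (adj (G c) x) e ⟨ trans ⟩ ¬Adj⇒false c x y ¬e
        ... | inj₁ (i<2+s , e) with snoc-case (vert P) x (m<1+n⇒m≤n i<2+s)
        ...   | inj₁ (i<1+s , e′) = cong (adj (G c) x) (e ⟨ trans ⟩ e′) ⟨ trans ⟩ off-path-isolated x∉P i (m<1+n⇒m≤n i<1+s)
        ...   | inj₂ (_ , e′)     = cong (adj (G c) x) (e ⟨ trans ⟩ e′) ⟨ trans ⟩ adj-irrefl (G c) x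

  twoCliques : ∀ {s} (P : RainbowPath s) → s + 2 ≤ n → (∀ c → ¬ Crossing P c) → TwoCliques G
  twoCliques {s} P s+2≤n no-crossing = suc s , S , s≤s z≤n , 1+s≤n∸1 , ∣S∣≡1+s , edges
    where
    S = decSubset (OnPath? P)
    ∣S∣≡1+s : ∣ S ∣ ≡ suc s
    ∣S∣≡1+s = ∣decSubset∣≡ (OnPath? P) (suc s) (vert P) (λ i i<1+s → i , m<1+n⇒m≤n i<1+s , refl)
      (vert-injective< P) (λ x (j , j≤s , e) → j , s≤s j≤s , e)
    1+s≤n∸1 : suc s ≤ n ∸ 1
    1+s≤n∸1 = m+n≤o⇒m≤o∸n (suc s) (subst (_≤ n) (+-suc s 1) s+2≤n)
    closed : ∀ c {x y} → Adj c x y → x ∈ S → y ∈ S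
    closed c {x} {y} e x∈S with OnPath? P y
    ... | yes y∈P = ∈decSubset⁺ (OnPath? P) y∈P
    ... | no  y∉P = ⊥-elim (no-crossing c (x , y , ∈decSubset⁻ (OnPath? P) x∈S , y∉P , e))
    edges : ∀ c x y → (Adj c x y → (x ≢ y × (x ∈ S → y ∈ S) × (y ∈ S → x ∈ S)))
                    × ((x ≢ y × (x ∈ S → y ∈ S) × (y ∈ S → x ∈ S)) → Adj c x y)
    edges c x y = (λ e → Adj⇒≢ c x y e , closed c e , closed c (Adj-sym c x y e)) , complete
      where
      open NoCrossing P s+2≤n c (no-crossing c)
      complete : (x ≢ y × (x ∈ S → y ∈ S) × (y ∈ S → x ∈ S)) → Adj c x y
      complete (x≢y , x→y , y→x) with OnPath? P x | OnPath? P y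
      ... | yes x∈P | _       = complete-on-path x∈P (∈decSubset⁻ (OnPath? P) (x→y (∈decSubset⁺ (OnPath? P) x∈P))) x≢y
      ... | no  x∉P | yes y∈P = ⊥-elim (x∉P (∈decSubset⁻ (OnPath? P) (y→x (∈decSubset⁺ (OnPath? P) y∈P))))
      ... | no  x∉P | no  y∉P = complete-off-path x∉P y∉P x≢y

  cycle-length-pos : ∀ {s} → RainbowCycle s → 0 < s
  cycle-length-pos {zero}  C = ⊥-elim (Adj⇒≢ _ _ _ (closing-edge C) refl)
  cycle-length-pos {suc s} C = s≤s z≤n

  -- Recolouring the c-edge with f, or making f the closing colour, frees c.
  make-spare : ∀ {s} (C : RainbowCycle s) f → Spare C f →
    (∀ {x y} → OnPath (path C) x → OnPath (path C) y → x ≢ y → Adj f x y) →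
    ∀ c → Σ (RainbowCycle s) λ C′ → (∀ j → vert (path C′) j ≡ vert (path C) j) × Spare C′ c
  make-spare {s} C@(cycle P d d-free closing) f (f-free , f≢d) f-complete c
    with anyUpTo? (λ i → col P i Finₚ.≟ c) s
  ... | yes (r , r<s , colr≡c) = cycle P′ d (recolour-Free d-free (f≢d ∘ sym)) closing , (λ _ → refl) ,
        subst (Free P′) colr≡c recolour-frees , λ c≡d → d-free r r<s (trans colr≡c c≡d)
    where
    f-edge : Adj f (vert P r) (vert P (suc r))
    f-edge = f-complete (r , <⇒≤ r<s , refl) (suc r , r<s , refl)
      (λ e → <⇒≢ (n<1+n r) (vert-injective P r (suc r) (<⇒≤ r<s) r<s e))
    open Recolouring P r f r<s f-free f-edge
    P′ = recolour
  ... | no c-unused with c Finₚ.≟ d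
  ...   | no  c≢d  = C , (λ _ → refl) , (λ i i<s e → c-unused (i , i<s , e)) , c≢d
  ...   | yes refl = cycle P f f-free f-closing , (λ _ → refl) , d-free , f≢d ∘ sym
    where
    f-closing : Adj f (vert P s) (vert P 0)
    f-closing = f-complete (s , ≤-refl , refl) (0 , z≤n , refl)
      (λ e → <⇒≢ (cycle-length-pos C) (sym (vert-injective P s 0 ≤-refl z≤n e)))

  cycle-progress : ∀ {s} → s + 2 ≤ n → (C : RainbowCycle s) → ∀ f → Spare C f → Progress s
  cycle-progress {s} s+2≤n C f f-spare with Crossing? (path C) f
  ... | yes (u , y , u∈C , y∉C , e) = inj₁ (open-and-extend C f f-spare u∈C y∉C e)
  ... | no ¬f-crossing with Finₚ.any? (Crossing? (path C))
  ...   | no  ¬crossing = inj₂ (inj₁ (twoCliques (path C) s+2≤n λ c c-crossing → ¬crossing (c , c-crossing)))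
  ...   | yes (c , u , y , (j , j≤s , vj≡u) , y∉C , e)
    with make-spare C f f-spare (NoCrossing.complete-on-path (path C) s+2≤n f ¬f-crossing) c
  ...     | C′ , same , c-spare = inj₁ (open-and-extend C′ c c-spare (j , j≤s , trans (same j) vj≡u)
            (λ (i , i≤s , vi≡y) → y∉C (i , i≤s , trans (sym (same i)) vi≡y)) e)

  extend-end : ∀ {s} (P : RainbowPath s) c → Free P c → ProgressOr s (∀ y → ¬ OnPath P y → ¬ Adj c (vert P s) y)
  extend-end {s} P c c-free with Finₚ.any? (λ y → ¬? (OnPath? P y) ×-dec Adj? c (vert P s) y)
  ... | yes (y , y∉P , e) = longer (extend P y c y∉P c-free e)
  ... | no  stuck         = inj₂ λ y y∉P e → stuck (y , y∉P , e)

  extend-start : ∀ {s} (P : RainbowPath s) c → Free P c → ProgressOr s (∀ y → ¬ OnPath P y → ¬ Adj c (vert P 0) y)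
  extend-start {s} P c c-free with Finₚ.any? (λ y → ¬? (OnPath? P y) ×-dec Adj? c (vert P 0) y)
  ... | yes (y , y∉P , e) = longer (extend-at-start P y c y∉P c-free e)
  ... | no  stuck         = inj₂ λ y y∉P e → stuck (y , y∉P , e)

  record Stuck {s} (P : RainbowPath s) (c : Fin m) : Set where
    field
      start-stuck : ∀ y → ¬ OnPath P y → ¬ Adj c (vert P 0) y
      end-stuck   : ∀ y → ¬ OnPath P y → ¬ Adj c (vert P s) y
      ends-apart  : ¬ Adj c (vert P 0) (vert P s)

  Uncrossed : ∀ {s} → RainbowPath s → Fin m → Fin m → Set
  Uncrossed {s} P a b = ∀ i → i < s → Adj a (vert P 0) (vert P (suc i)) → Adj b (vert P s) (vert P i) → ⊥

  NoStartDetour : ∀ {s} → RainbowPath s → Fin n → Fin m → Fin m → Set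
  NoStartDetour {s} P w a b = ∀ j → j < s → Adj a (vert P 0) (vert P (suc j)) → ¬ Adj b w (vert P j)

  NoEndDetour : ∀ {s} → RainbowPath s → Fin n → Fin m → Fin m → Set
  NoEndDetour {s} P w a b = ∀ j → j < s → Adj a (vert P s) (vert P j) → ¬ Adj b w (vert P (suc j))

  record Extremal {s} (P : RainbowPath s) (f : Fin m) (w : Fin n) : Set where
    field
      length≡     : s + 2 ≡ n
      even-length : even s ≡ true
      even-chords : ∀ i → i < s → even i ≡ true → Adj f (vert P 0) (vert P (suc i))
      start-odd   : ∀ y → Adj f (vert P 0) y → OnOddPosition P y
      outside-odd : ∀ y → Adj f w y → OnOddPosition P y

  module EndDegrees {s} (P : RainbowPath s) (s>0 : 0 < s) where

    startAdj : Fin m → ℕ → Bool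
    startAdj c i = adj (G c) (vert P 0) (vert P (suc i))

    endAdj : Fin m → ℕ → Bool
    endAdj c i = adj (G c) (vert P s) (vert P i)

    a : Fin m → ℕ
    a c = count (startAdj c) s

    b : Fin m → ℕ
    b c = count (endAdj c) s

    start-neighbour : ∀ c → Stuck P c → ∀ y → Adj c (vert P 0) y → ∃ λ i → i < s × vert P (suc i) ≡ y
    start-neighbour c stuck y e with OnPath? P y
    ... | no  y∉P = ⊥-elim (Stuck.start-stuck stuck y y∉P e)
    ... | yes (zero , _ , v₀≡y)    = ⊥-elim (Adj⇒≢ c _ _ e v₀≡y)
    ... | yes (suc i , i<s , e′) = i , i<s , e′

    end-neighbour : ∀ c → Stuck P c → ∀ y → Adj c (vert P s) y → ∃ λ i → i < s × vert P i ≡ y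
    end-neighbour c stuck y e with OnPath? P y
    ... | no  y∉P = ⊥-elim (Stuck.end-stuck stuck y y∉P e)
    ... | yes (j , j≤s , e′) with m≤n⇒m<n∨m≡n j≤s
    ...   | inj₁ j<s  = j , j<s , e′
    ...   | inj₂ refl = ⊥-elim (Adj⇒≢ c _ _ e e′)

    degree≤count : ∀ c x (q : ℕ → Bool) (index : ℕ → ℕ) →
      (∀ y → Adj c x y → ∃ λ j → j < s × vert P (index j) ≡ y) →
      (∀ j → j < s → Adj c x (vert P (index j)) → q j ≡ true) → degree c x ≤ count q s
    degree≤count c x q index position q-holds = countᶠ-≤-surjection (adj (G c) x) q s (vert P ∘ index) onto
      where
      onto : ∀ y → adj (G c) x y ≡ true → ∃ λ j → j < s × q j ≡ true × vert P (index j) ≡ y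
      onto y e with position y e
      ... | j , j<s , e′ = j , j<s , q-holds j j<s (subst (Adj c x) (sym e′) e) , e′

    start-degree≤ : ∀ c → Stuck P c → degree c (vert P 0) ≤ a c
    start-degree≤ c stuck = degree≤count c (vert P 0) (startAdj c) suc (start-neighbour c stuck) (λ _ _ e → e)

    end-degree≤ : ∀ c → Stuck P c → degree c (vert P s) ≤ b c
    end-degree≤ c stuck = degree≤count c (vert P s) (endAdj c) (λ j → j) (end-neighbour c stuck) (λ _ _ e → e)

    σ₂-ends : ∀ c → Stuck P c → n ∸ 2 ≤ a c + b c
    σ₂-ends c stuck = ≤-trans
      (σ₂-bound c (vert P 0) (vert P s) (λ e → <⇒≢ s>0 (vert-injective P 0 s z≤n ≤-refl e)) (Stuck.ends-apart stuck))
      (+-mono-≤ (start-degree≤ c stuck) (end-degree≤ c stuck))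

    uncrossed≤ : ∀ {x y} → Uncrossed P x y → a x + b y ≤ s
    uncrossed≤ {x} {y} u = count-disjoint (startAdj x) (endAdj y) s u

    uncrossed-cover : ∀ {x y} → Uncrossed P x y → s ≤ a x + b y →
      ∀ i → i < s → startAdj x i ≡ false → endAdj y i ≡ true
    uncrossed-cover {x} {y} u = count-cover (startAdj x) (endAdj y) s u

  -- Stuck ends give n − 2 ≤ a c + b c and uncrossed chords give a x + b y ≤ s; together they force
  -- s = n − 2 and make the start-chords and end-chords of f₁ complementary (cover₁₁).
  module Ore {s} (P : RainbowPath s) (s>0 : 0 < s) (s+2≤n : s + 2 ≤ n) (f₁ f₂ f₃ : Fin m)
             (stuck₁ : Stuck P f₁) (stuck₂ : Stuck P f₂) (stuck₃ : Stuck P f₃)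
             (u₁₂ : Uncrossed P f₁ f₂) (u₂₁ : Uncrossed P f₂ f₁) (u₂₃ : Uncrossed P f₂ f₃)
             (u₃₂ : Uncrossed P f₃ f₂) (u₃₁ : Uncrossed P f₃ f₁) where

    open EndDegrees P s>0

    s≤n∸2 : s ≤ n ∸ 2
    s≤n∸2 = m+n≤o⇒m≤o∸n s s+2≤n

    n∸2≤s : n ∸ 2 ≤ s
    n∸2≤s = double-cancel-≤ (n ∸ 2) s (begin
      (n ∸ 2) + (n ∸ 2)             ≤⟨ +-mono-≤ (σ₂-ends f₁ stuck₁) (σ₂-ends f₂ stuck₂) ⟩
      (a f₁ + b f₁) + (a f₂ + b f₂) ≡⟨ swap-b (a f₁) (b f₁) (a f₂) (b f₂) ⟩
      (a f₁ + b f₂) + (a f₂ + b f₁) ≤⟨ +-mono-≤ (uncrossed≤ u₁₂) (uncrossed≤ u₂₁) ⟩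
      s + s                         ∎)
      where
      open ≤-Reasoning
      swap-b : ∀ w x y z → (w + x) + (y + z) ≡ (w + z) + (y + x)
      swap-b w x y z = interchange w x y z ⟨ trans ⟩ cong ((w + y) +_) (+-comm x z) ⟨ trans ⟩ interchange w y z x

    length≡ : s + 2 ≡ n
    length≡ = ≤-antisym s+2≤n (≤-trans (m≤n+m∸n n 2) (subst (_≤ s + 2) (+-comm (n ∸ 2) 2) (+-monoˡ-≤ 2 n∸2≤s)))

    s≤a+b : ∀ c → Stuck P c → s ≤ a c + b c
    s≤a+b c stuck = ≤-trans s≤n∸2 (σ₂-ends c stuck)

    b≤b : ∀ {x y} → Stuck P y → Uncrossed P y x → b x ≤ b y
    b≤b {x} {y} stuck u = +-cancelˡ-≤ (a y) _ _ (≤-trans (uncrossed≤ u) (s≤a+b y stuck))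

    cover : ∀ {x y} → Stuck P x → Uncrossed P x y → b x ≤ b y → ∀ i → i < s → startAdj x i ≡ false → endAdj y i ≡ true
    cover {x} stuck u bx≤by = uncrossed-cover u (≤-trans (s≤a+b x stuck) (+-monoʳ-≤ (a x) bx≤by))

    cover₁₂ : ∀ i → i < s → startAdj f₁ i ≡ false → endAdj f₂ i ≡ true
    cover₁₂ = cover stuck₁ u₁₂ (b≤b stuck₂ u₂₁)

    cover₂₁ : ∀ i → i < s → startAdj f₂ i ≡ false → endAdj f₁ i ≡ true
    cover₂₁ = cover stuck₂ u₂₁ (b≤b stuck₁ u₁₂)

    u₁₁ : Uncrossed P f₁ f₁
    u₁₁ i i<s start₁ end₁ with startAdj f₃ i in start₃
    ... | true  = u₃₁ i i<s start₃ end₁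
    ... | false = u₁₂ i i<s start₁ (cover stuck₃ u₃₂ (b≤b stuck₂ u₂₃) i i<s start₃)

    cover₁₁ : ∀ i → i < s → startAdj f₁ i ≡ false → endAdj f₁ i ≡ true
    cover₁₁ = uncrossed-cover u₁₁ (s≤a+b f₁ stuck₁)

    1+pred≡s : suc (pred s) ≡ s
    1+pred≡s = suc-pred s ⦃ >-nonZero s>0 ⦄

    pred<s : pred s < s
    pred<s = subst (pred s <_) 1+pred≡s (n<1+n (pred s))

    module Outside (w : Fin n) (w∉P : ¬ OnPath P w)
                   (detour₀ : NoStartDetour P w f₂ f₁) (detourₛ : NoEndDetour P w f₂ f₁) where

      w≁v₀ : ¬ Adj f₁ w (vert P 0)
      w≁v₀ e = Stuck.start-stuck stuck₁ w w∉P (Adj-sym f₁ _ _ e)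

      w≁vₛ : ¬ Adj f₁ w (vert P s)
      w≁vₛ e = Stuck.end-stuck stuck₁ w w∉P (Adj-sym f₁ _ _ e)

      w-neighbour-end : ∀ j → j < s → Adj f₁ w (vert P j) → endAdj f₁ j ≡ true
      w-neighbour-end j j<s e with startAdj f₂ j in start₂
      ... | true  = ⊥-elim (detour₀ j j<s start₂ e)
      ... | false = cover₂₁ j j<s start₂

      w-neighbour-start : ∀ i → i < s → Adj f₁ w (vert P (suc i)) → startAdj f₁ i ≡ true
      w-neighbour-start i i<s e with startAdj f₁ i in start₁
      ... | true  = refl
      ... | false = ⊥-elim (detourₛ i i<s (cover₁₂ i i<s start₁) e)

      w-neighbour-position : ∀ y → Adj f₁ w y → ∃ λ j → j < s × vert P j ≡ y
      w-neighbour-position y e with OnPath? P y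
      ... | no  y∉P = ⊥-elim (Adj⇒≢ f₁ w y e (offPath-unique P length≡ w∉P y∉P))
      ... | yes (j , j≤s , vj≡y) with m≤n⇒m<n∨m≡n j≤s
      ...   | inj₁ j<s  = j , j<s , vj≡y
      ...   | inj₂ refl = ⊥-elim (w≁vₛ (subst (Adj f₁ w) (sym vj≡y) e))

      w-neighbour-position′ : ∀ y → Adj f₁ w y → ∃ λ i → i < s × vert P (suc i) ≡ y
      w-neighbour-position′ y e with w-neighbour-position y e
      ... | zero  , _   , v₀≡y = ⊥-elim (w≁v₀ (subst (Adj f₁ w) (sym v₀≡y) e))
      ... | suc i , 1+i<s , e′ = i , <-trans (n<1+n i) 1+i<s , e′

      w-neighbour-index< : ∀ j → j ≤ s → Adj f₁ w (vert P j) → j < s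
      w-neighbour-index< j j≤s e with m≤n⇒m<n∨m≡n j≤s
      ... | inj₁ j<s  = j<s
      ... | inj₂ refl = ⊥-elim (w≁vₛ e)

      b₁≤degree-w : b f₁ ≤ degree f₁ w
      b₁≤degree-w = +-cancelˡ-≤ (a f₁) _ _ (begin
        a f₁ + b f₁                        ≤⟨ uncrossed≤ u₁₁ ⟩
        s                                  ≤⟨ s≤n∸2 ⟩
        n ∸ 2                              ≤⟨ σ₂-bound f₁ w (vert P 0) (λ e → w∉P (0 , z≤n , sym e)) w≁v₀ ⟩
        degree f₁ w + degree f₁ (vert P 0) ≤⟨ +-monoʳ-≤ (degree f₁ w) (start-degree≤ f₁ stuck₁) ⟩
        degree f₁ w + a f₁                 ≡⟨ +-comm (degree f₁ w) (a f₁) ⟩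
        a f₁ + degree f₁ w                 ∎)
        where open ≤-Reasoning

      a₁≤degree-w : a f₁ ≤ degree f₁ w
      a₁≤degree-w = +-cancelʳ-≤ (b f₁) _ _ (begin
        a f₁ + b f₁                        ≤⟨ uncrossed≤ u₁₁ ⟩
        s                                  ≤⟨ s≤n∸2 ⟩
        n ∸ 2                              ≤⟨ σ₂-bound f₁ w (vert P s) (λ e → w∉P (s , ≤-refl , sym e)) w≁vₛ ⟩
        degree f₁ w + degree f₁ (vert P s) ≤⟨ +-monoʳ-≤ (degree f₁ w) (end-degree≤ f₁ stuck₁) ⟩
        degree f₁ w + b f₁                 ∎)
        where open ≤-Reasoning

      -- b f₁ ≤ deg w and every f₁-neighbour of w is an end-chord endpoint, so they coincide.
      end⇒w-neighbour : ∀ i → i < s → endAdj f₁ i ≡ true → Adj f₁ w (vert P i)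
      end⇒w-neighbour i i<s end₁ with Adj? f₁ w (vert P i)
      ... | yes e  = e
      ... | no  ¬e = ⊥-elim (<-irrefl refl (≤-trans (≤-reflexive (sym (count-erase (endAdj f₁) s i i<s end₁)))
        (≤-trans b₁≤degree-w (degree≤count f₁ w (erase (endAdj f₁) i) (λ j → j) w-neighbour-position erased))))
        where
        erased : ∀ j → j < s → Adj f₁ w (vert P j) → erase (endAdj f₁) i j ≡ true
        erased j j<s e = erase-≢ (endAdj f₁) (λ j≡i → ¬e (subst (λ k → Adj f₁ w (vert P k)) j≡i e))
          ⟨ trans ⟩ w-neighbour-end j j<s e

      start⇒w-neighbour : ∀ i → i < s → startAdj f₁ i ≡ true → Adj f₁ w (vert P (suc i))
      start⇒w-neighbour i i<s start₁ with Adj? f₁ w (vert P (suc i))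
      ... | yes e  = e
      ... | no  ¬e = ⊥-elim (<-irrefl refl (≤-trans (≤-reflexive (sym (count-erase (startAdj f₁) s i i<s start₁)))
        (≤-trans a₁≤degree-w (degree≤count f₁ w (erase (startAdj f₁) i) suc w-neighbour-position′ erased))))
        where
        erased : ∀ j → j < s → Adj f₁ w (vert P (suc j)) → erase (startAdj f₁) i j ≡ true
        erased j j<s e = erase-≢ (startAdj f₁) (λ j≡i → ¬e (subst (λ k → Adj f₁ w (vert P (suc k))) j≡i e))
          ⟨ trans ⟩ w-neighbour-start j j<s e

      end⇒start-before : ∀ i → i < s → endAdj f₁ i ≡ true → ∃ λ i′ → i ≡ suc i′ × startAdj f₁ i′ ≡ true
      end⇒start-before zero     0<s  end₁ = ⊥-elim (w≁v₀ (end⇒w-neighbour 0 0<s end₁))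
      end⇒start-before (suc i′) i<s end₁ =
        i′ , refl , w-neighbour-start i′ (<-trans (n<1+n i′) i<s) (end⇒w-neighbour (suc i′) i<s end₁)

      start⇒end-after : ∀ i → i < s → startAdj f₁ i ≡ true → suc i < s × endAdj f₁ (suc i) ≡ true
      start⇒end-after i i<s start₁ = 1+i<s , w-neighbour-end (suc i) 1+i<s e
        where
        e = start⇒w-neighbour i i<s start₁
        1+i<s = w-neighbour-index< (suc i) i<s e

      start-excludes-end : ∀ i → i < s → endAdj f₁ i ≡ true → startAdj f₁ i ≡ false
      start-excludes-end i i<s end₁ with startAdj f₁ i in start₁
      ... | true  = ⊥-elim (u₁₁ i i<s start₁ end₁)
      ... | false = refl

      startAdj-parity : ∀ i → i < s → startAdj f₁ i ≡ even i
      startAdj-parity zero 0<s with startAdj f₁ 0 in start₀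
      ... | true  = refl
      ... | false with end⇒start-before 0 0<s (cover₁₁ 0 0<s start₀)
      ...   | _ , () , _
      startAdj-parity (suc i) 1+i<s with startAdj f₁ i in startᵢ | startAdj-parity i (<-trans (n<1+n i) 1+i<s)
      ... | true  | even-i = start-excludes-end (suc i) 1+i<s (proj₂ (start⇒end-after i (<-trans (n<1+n i) 1+i<s) startᵢ))
                              ⟨ trans ⟩ cong not even-i
      ... | false | even-i = start-next ⟨ trans ⟩ cong not even-i
        where
        start-next : startAdj f₁ (suc i) ≡ true
        start-next with startAdj f₁ (suc i) in start′
        ... | true  = refl
        ... | false with end⇒start-before (suc i) 1+i<s (cover₁₁ (suc i) 1+i<s start′)
        ...   | _ , refl , startᵢ′ = contradiction (sym startᵢ′ ⟨ trans ⟩ startᵢ) λ ()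

      even-length : even s ≡ true
      even-length with startAdj f₁ (pred s) in last
      ... | true  = ⊥-elim (<-irrefl 1+pred≡s (proj₁ (start⇒end-after (pred s) pred<s last)))
      ... | false = cong even (sym 1+pred≡s) ⟨ trans ⟩ cong not (sym (startAdj-parity (pred s) pred<s) ⟨ trans ⟩ last)

      extremal : Extremal P f₁ w
      extremal = record
        { length≡     = length≡
        ; even-length = even-length
        ; even-chords = λ i i<s even-i → startAdj-parity i i<s ⟨ trans ⟩ even-i
        ; start-odd   = start-odd
        ; outside-odd = outside-odd
        }
        where
        start-odd : ∀ y → Adj f₁ (vert P 0) y → OnOddPosition P y
        start-odd y e with start-neighbour f₁ stuck₁ y e
        ... | i , i<s , e′ = suc i , i<s ,
          cong not (sym (startAdj-parity i i<s) ⟨ trans ⟩ cong (adj (G f₁) (vert P 0)) e′ ⟨ trans ⟩ e) , e′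
        outside-odd : ∀ y → Adj f₁ w y → OnOddPosition P y
        outside-odd y e with w-neighbour-position y e
        ... | j , j<s , e′ = j , <⇒≤ j<s ,
          (sym (startAdj-parity j j<s) ⟨ trans ⟩ start-excludes-end j j<s (w-neighbour-end j j<s (subst (Adj f₁ w) (sym e′) e))) , e′

  stuck-or-progress : ∀ {s} (P : RainbowPath s) → s + 2 ≤ n → ∀ c → Free P c → ∀ g → Free P g → g ≢ c →
    ProgressOr s (Stuck P c)
  stuck-or-progress {s} P s+2≤n c c-free g g-free g≢c = do
    start ← extend-start P c c-free
    end   ← extend-end P c c-free
    close start end
    where
    close : (∀ y → ¬ OnPath P y → ¬ Adj c (vert P 0) y) → (∀ y → ¬ OnPath P y → ¬ Adj c (vert P s) y) →
      ProgressOr s (Stuck P c)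
    close start end with Adj? c (vert P 0) (vert P s)
    ... | yes e  = inj₁ (cycle-progress s+2≤n (cycle P c c-free (Adj-sym c _ _ e)) g (g-free , g≢c))
    ... | no  ¬e = inj₂ record { start-stuck = start ; end-stuck = end ; ends-apart = ¬e }

  -- Crossed chords a : v₀ vᵢ₊₁ and b : vₛ vᵢ close the rainbow cycle vᵢ … v₀ vᵢ₊₁ … vₛ vᵢ.
  uncrossed-or-progress : ∀ {s} (P : RainbowPath s) → s + 2 ≤ n → ∀ a b c → Free P a → Free P b → Free P c →
    b ≢ a → c ≢ a → c ≢ b → ProgressOr s (Uncrossed P a b)
  uncrossed-or-progress {s} P s+2≤n a b c a-free b-free c-free b≢a c≢a c≢b
    with anyUpTo? (λ i → Adj? a (vert P 0) (vert P (suc i)) ×-dec Adj? b (vert P s) (vert P i)) s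
  ... | no  uncrossed = inj₂ λ i i<s ea eb → uncrossed (i , i<s , ea , eb)
  ... | yes (i , i<s , ea , eb) = inj₁ (cycle-progress s+2≤n C c (rotate-Free c-free c≢a , c≢b))
    where
    open Rotation P i a i<s a-free ea
    C : RainbowCycle s
    C = cycle rotate b (rotate-Free b-free b≢a) (subst₂ (Adj b) (sym rotate-end) (sym rotate-start) eb)

  -- Rotating by the chord a : v₀ vⱼ₊₁ brings vⱼ to the front, where w can be attached in colour b.
  no-start-detour : ∀ {s} (P : RainbowPath s) w → ¬ OnPath P w → ∀ a b → Free P a → Free P b → b ≢ a →
    ProgressOr s (NoStartDetour P w a b)
  no-start-detour {s} P w w∉P a b a-free b-free b≢a
    with anyUpTo? (λ j → Adj? a (vert P 0) (vert P (suc j)) ×-dec Adj? b w (vert P j)) s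
  ... | no  none = inj₂ λ j j<s ea eb → none (j , j<s , ea , eb)
  ... | yes (j , j<s , ea , eb) = longer (extend-at-start rotate w b (w∉P ∘ rotate-OnPath) (rotate-Free b-free b≢a)
      (subst (λ x → Adj b x w) (sym rotate-start) (Adj-sym b w _ eb)))
    where open Rotation P j a j<s a-free ea

  no-end-detour : ∀ {s} (P : RainbowPath s) w → ¬ OnPath P w → ∀ a b → Free P a → Free P b → b ≢ a →
    ProgressOr s (NoEndDetour P w a b)
  no-end-detour {s} P w w∉P a b a-free b-free b≢a = do
    none ← no-start-detour (reverse P) w (w∉P ∘ reverse-OnPath P) a b (reverse-Free P a-free) (reverse-Free P b-free) b≢a
    inj₂ λ j j<s ea eb → none (s ∸ suc j) (m∸1+n<m j<s)
      (subst (λ k → Adj a (vert P s) (vert P k)) (sym (s∸[s∸1+j]≡j j<s)) ea)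
      (subst (λ k → Adj b w (vert P k)) (sym (m∸[m∸n]≡n j<s)) eb)
    where
    s∸[s∸1+j]≡j : ∀ {j} → j < s → s ∸ suc (s ∸ suc j) ≡ j
    s∸[s∸1+j]≡j j<s = cong (s ∸_) (suc[m∸1+n]≡m∸n j<s) ⟨ trans ⟩ m∸[m∸n]≡n (<⇒≤ j<s)

  extremal-or-progress : ∀ {s} (P : RainbowPath s) → 0 < s → s + 2 ≤ n → (F : Palette P) → ∀ w → ¬ OnPath P w →
    ProgressOr s (Extremal P (Palette.f₁ F) w)
  extremal-or-progress P s>0 s+2≤n F w w∉P = do
    stuck₁  ← stuck-or-progress P s+2≤n f₁ f₁-free f₂ f₂-free (f₁≢f₂ ∘ sym)
    stuck₂  ← stuck-or-progress P s+2≤n f₂ f₂-free f₁ f₁-free f₁≢f₂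
    stuck₃  ← stuck-or-progress P s+2≤n f₃ f₃-free f₁ f₁-free f₁≢f₃
    u₁₂     ← uncrossed-or-progress P s+2≤n f₁ f₂ f₃ f₁-free f₂-free f₃-free (f₁≢f₂ ∘ sym) (f₁≢f₃ ∘ sym) (f₂≢f₃ ∘ sym)
    u₂₁     ← uncrossed-or-progress P s+2≤n f₂ f₁ f₃ f₂-free f₁-free f₃-free f₁≢f₂ (f₂≢f₃ ∘ sym) (f₁≢f₃ ∘ sym)
    u₂₃     ← uncrossed-or-progress P s+2≤n f₂ f₃ f₁ f₂-free f₃-free f₁-free (f₂≢f₃ ∘ sym) f₁≢f₂ f₁≢f₃
    u₃₂     ← uncrossed-or-progress P s+2≤n f₃ f₂ f₁ f₃-free f₂-free f₁-free f₂≢f₃ f₁≢f₃ f₁≢f₂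
    u₃₁     ← uncrossed-or-progress P s+2≤n f₃ f₁ f₂ f₃-free f₁-free f₂-free f₁≢f₃ f₂≢f₃ (f₁≢f₂ ∘ sym)
    detour₀ ← no-start-detour P w w∉P f₂ f₁ f₂-free f₁-free f₁≢f₂
    detourₛ ← no-end-detour P w w∉P f₂ f₁ f₂-free f₁-free f₁≢f₂
    inj₂ (Ore.Outside.extremal P s>0 s+2≤n f₁ f₂ f₃ stuck₁ stuck₂ stuck₃ u₁₂ u₂₁ u₂₃ u₃₂ u₃₁ w w∉P detour₀ detourₛ)
    where open Palette F

  OddNeighbours : ∀ {s} → RainbowPath s → Fin n → Fin m → Set
  OddNeighbours Q w c = (∀ y → Adj c (vert Q 0) y → OnOddPosition Q y) × (∀ y → Adj c w y → OnOddPosition Q y)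

  OddNeighbours? : ∀ {s} (Q : RainbowPath s) w c → Dec (OddNeighbours Q w c)
  OddNeighbours? Q w c = Finₚ.all? (λ y → Adj? c (vert Q 0) y →-dec OnOddPosition? Q y)
                   ×-dec Finₚ.all? (λ y → Adj? c w y →-dec OnOddPosition? Q y)

  extremal⇒OddNeighbours : ∀ {s} {Q : RainbowPath s} {f w} → Extremal Q f w → OddNeighbours Q w f
  extremal⇒OddNeighbours ext = Extremal.start-odd ext , Extremal.outside-odd ext

  all-or-progress : ∀ {s k} {P : Fin k → Set} → (∀ c → Dec (P c)) → (∀ c → ProgressOr s (P c)) → ProgressOr s (∀ c → P c)
  all-or-progress P? attempt with Finₚ.any? (λ c → ¬? (P? c))
  ... | no  none = inj₂ λ c → decidable-stable (P? c) λ ¬Pc → none (c , ¬Pc)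
  ... | yes (c , ¬Pc) with attempt c
  ...   | inj₁ p  = inj₁ p
  ...   | inj₂ Pc = ⊥-elim (¬Pc Pc)

  allUpTo-or-progress : ∀ {s} {P : ℕ → Set} → (∀ j → Dec (P j)) → ∀ r → (∀ j → j < r → ProgressOr s (P j)) →
    ProgressOr s (∀ j → j < r → P j)
  allUpTo-or-progress P? r attempt with anyUpTo? (λ j → ¬? (P? j)) r
  ... | no  none = inj₂ λ j j<r → decidable-stable (P? j) λ ¬Pj → none (j , j<r , ¬Pj)
  ... | yes (j , j<r , ¬Pj) with attempt j j<r
  ...   | inj₁ p  = inj₁ p
  ...   | inj₂ Pj = ⊥-elim (¬Pj Pj)

  module Saturation {s} (Q : RainbowPath s) (s>0 : 0 < s) (s+2≤n : s + 2 ≤ n) (F : Palette Q) (w : Fin n)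
                    (w∉Q : ¬ OnPath Q w) (ext : Extremal Q (Palette.f₁ F) w) where

    open Palette F

    odd-if-free : ∀ c → Free Q c → ProgressOr s (OddNeighbours Q w c)
    odd-if-free c c-free with c Finₚ.≟ f₁ | c Finₚ.≟ f₂
    ... | yes refl | _        = inj₂ (extremal⇒OddNeighbours ext)
    ... | no  _    | yes refl = do
      ext₂ ← extremal-or-progress Q s>0 s+2≤n (swap₁₂ F) w w∉Q
      inj₂ (extremal⇒OddNeighbours ext₂)
    ... | no c≢f₁  | no c≢f₂  = do
      extc ← extremal-or-progress Q s>0 s+2≤n (prepend F c c-free c≢f₁ c≢f₂) w w∉Q
      inj₂ (extremal⇒OddNeighbours extc)

    -- Rotate or reverse Q so that an end of the edge comes first and its other end second;
    -- then f₂ leads the palette and the even chord at position 0 is the edge itself.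
    f₂-edge : ∀ p → p < s → ProgressOr s (Adj f₂ (vert Q p) (vert Q (suc p)))
    f₂-edge p p<s with even p in even-p
    ... | true = do
      ext₂ ← extremal-or-progress rotate s>0 s+2≤n (rotate-palette F p<s chord) w (w∉Q ∘ rotate-OnPath)
      inj₂ (subst₂ (Adj f₂) rotate-start (cong (vert Q) (flipPrefix-> (n<1+n p))) (Extremal.even-chords ext₂ p p<s even-p))
      where
      chord = Extremal.even-chords ext p p<s even-p
      open Rotation Q p f₁ p<s f₁-free chord
    ... | false with m<1+n⇒m<n∨m≡n (s≤s p<s)
    ...   | inj₁ 1+p<s = do
      ext₂ ← extremal-or-progress rotate s>0 s+2≤n (rotate-palette F 1+p<s chord) w (w∉Q ∘ rotate-OnPath)
      inj₂ (Adj-sym f₂ _ _ (subst (λ x → Adj f₂ x (vert Q p)) rotate-start (Extremal.even-chords ext₂ 0 s>0 refl)))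
      where
      chord = Extremal.even-chords ext (suc p) 1+p<s (cong not even-p)
      open Rotation Q (suc p) f₁ 1+p<s f₁-free chord
    ...   | inj₂ 1+p≡s = do
      ext₂ ← extremal-or-progress (reverse Q) s>0 s+2≤n (roll (reverse-palette F)) w (w∉Q ∘ reverse-OnPath Q)
      inj₂ (Adj-sym f₂ _ _ (subst (λ k → Adj f₂ (vert Q k) (vert Q (k ∸ 1))) (sym 1+p≡s) (Extremal.even-chords ext₂ 0 s>0 refl)))

    odd-neighbours : ∀ c → ProgressOr s (OddNeighbours Q w c)
    odd-neighbours c with anyUpTo? (λ i → col Q i Finₚ.≟ c) s
    ... | no  unused = odd-if-free c λ i i<s e → unused (i , i<s , e)
    ... | yes (p , p<s , colp≡c) = do
      e₂   ← f₂-edge p p<s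
      extp ← extremal-or-progress (Recolouring.recolour Q p f₂ p<s f₂-free e₂) s>0 s+2≤n (recolour-palette F p<s e₂) w w∉Q
      inj₂ (subst (OddNeighbours Q w) colp≡c (extremal⇒OddNeighbours extp))

  saturated-or-progress : ∀ {s} (Q : RainbowPath s) → 0 < s → s + 2 ≤ n → Palette Q → ∀ w → ¬ OnPath Q w →
    ProgressOr s (∀ c → OddNeighbours Q w c)
  saturated-or-progress Q s>0 s+2≤n F w w∉Q = do
    ext ← extremal-or-progress Q s>0 s+2≤n F w w∉Q
    all-or-progress (OddNeighbours? Q w) (Saturation.odd-neighbours Q s>0 s+2≤n F w w∉Q ext)

  module IndependentSet {s} (P : RainbowPath s) (s>0 : 0 < s) (s+2≤n : s + 2 ≤ n) (F : Palette P) (w : Fin n)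
                        (w∉P : ¬ OnPath P w) (ext : Extremal P (Palette.f₁ F) w) where

    open Palette F

    OddFrom : Fin n → Set
    OddFrom x = ∀ c y → Adj c x y → OnOddPosition P y

    OddFrom? : ∀ x → Dec (OddFrom x)
    OddFrom? x = Finₚ.all? λ c → Finₚ.all? λ y → Adj? c x y →-dec OnOddPosition? P y

    -- Rotating P by the f₁-chord at an even position, or reversing P, preserves the parity of positions.
    odd-from-even : ∀ j → j < suc s → ProgressOr s (even j ≡ true → OddFrom (vert P j))
    odd-from-even j j<1+s with even j Boolₚ.≟ true
    ... | no  odd-j  = inj₂ λ even-j → ⊥-elim (odd-j even-j)
    ... | yes even-j with m<1+n⇒m<n∨m≡n j<1+s
    ...   | inj₁ j<s = do
      odd ← saturated-or-progress rotate s>0 s+2≤n (rotate-palette F j<s chord) w (w∉P ∘ rotate-OnPath)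
      inj₂ λ _ c y e → ParitySub-odd rotate P (rotate-ParitySub even-j) (proj₁ (odd c) y (subst (λ x → Adj c x y) (sym rotate-start) e))
      where
      chord = Extremal.even-chords ext j j<s even-j
      open Rotation P j f₁ j<s f₁-free chord
    ...   | inj₂ refl = do
      odd ← saturated-or-progress (reverse P) s>0 s+2≤n (reverse-palette F) w (w∉P ∘ reverse-OnPath P)
      inj₂ λ _ c y e → ParitySub-odd (reverse P) P (reverse-ParitySub P (Extremal.even-length ext)) (proj₁ (odd c) y e)

    module _ (w-odd : OddFrom w) (even-odd : ∀ j → j < suc s → even j ≡ true → OddFrom (vert P j)) where

      h : ℕ
      h = proj₁ (even⇒double s (Extremal.even-length ext))

      s≡h+h : s ≡ h + h
      s≡h+h = proj₂ (even⇒double s (Extremal.even-length ext))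

      InY : Fin n → Set
      InY x = x ≡ w ⊎ OnEvenPosition P x

      InY? : ∀ x → Dec (InY x)
      InY? x = (x Finₚ.≟ w) ⊎-dec OnEvenPosition? P x

      Y : Subset n
      Y = decSubset InY?

      r+r≤s : ∀ {r} → r ≤ h → r + r ≤ s
      r+r≤s {r} r≤h = subst (r + r ≤_) (sym s≡h+h) (+-mono-≤ r≤h r≤h)

      evens : ℕ → Fin n
      evens r = vert P (r + r)

      members : ℕ → Fin n
      members = snoc evens (suc h) w

      members-injective : ∀ i j → i < 2 + h → j < 2 + h → members i ≡ members j → i ≡ j
      members-injective i j i< j< = snoc-injective evens (suc h) w
        (λ i j i≤h j≤h e → double-injective i j (vert-injective P _ _ (r+r≤s (m<1+n⇒m≤n i≤h)) (r+r≤s (m<1+n⇒m≤n j≤h)) e))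
        (λ r r≤h e → w∉P (r + r , r+r≤s (m<1+n⇒m≤n r≤h) , e)) i j (m<1+n⇒m≤n i<) (m<1+n⇒m≤n j<)

      members-InY : ∀ i → i < 2 + h → InY (members i)
      members-InY i i< with snoc-case evens w (m<1+n⇒m≤n i<)
      ... | inj₁ (i<1+h , e) = inj₂ (i + i , r+r≤s (m<1+n⇒m≤n i<1+h) , even-double i , sym e)
      ... | inj₂ (_ , e)     = inj₁ e

      members-onto : ∀ x → InY x → ∃ λ i → i < 2 + h × members i ≡ x
      members-onto x (inj₁ refl) = suc h , ≤-refl , snoc-≡ evens (suc h) w
      members-onto x (inj₂ (j , j≤s , even-j , vj≡x)) with even⇒double j even-j
      ... | r , j≡r+r = r , s≤s (m≤n⇒m≤1+n r≤h) , (snoc-< evens w (s≤s r≤h) ⟨ trans ⟩ cong (vert P) (sym j≡r+r) ⟨ trans ⟩ vj≡x)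
        where
        r≤h : r ≤ h
        r≤h = double-cancel-≤ r h (subst₂ _≤_ j≡r+r s≡h+h j≤s)

      InY-not-odd : ∀ {y} → InY y → ¬ OnOddPosition P y
      InY-not-odd (inj₁ refl) (j , j≤s , _ , vj≡w) = w∉P (j , j≤s , vj≡w)
      InY-not-odd (inj₂ (j , j≤s , even-j , vj≡y)) (j′ , j′≤s , odd-j′ , vj′≡y)
        with vert-injective P j j′ j≤s j′≤s (vj≡y ⟨ trans ⟩ sym vj′≡y)
      ... | refl = contradiction (sym even-j ⟨ trans ⟩ odd-j′) λ ()

      odd-from-InY : ∀ {x} → InY x → OddFrom x
      odd-from-InY (inj₁ refl)                    = w-odd
      odd-from-InY (inj₂ (j , j≤s , even-j , refl)) = even-odd j (s≤s j≤s) even-j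

      bigIndependent : BigIndependent G
      bigIndependent = suc h , Y , n≡ , ∣Y∣≡ , independent
        where
        n≡ : n ≡ suc h + suc h
        n≡ = sym (Extremal.length≡ ext) ⟨ trans ⟩ cong (_+ 2) s≡h+h ⟨ trans ⟩ +-comm (h + h) 2 ⟨ trans ⟩ cong suc (sym (+-suc h h))
        ∣Y∣≡ : ∣ Y ∣ ≡ suc (suc h)
        ∣Y∣≡ = ∣decSubset∣≡ InY? (2 + h) members members-InY members-injective members-onto
        independent : ∀ c x y → x ∈ Y → y ∈ Y → adj (G c) x y ≡ false
        independent c x y x∈Y y∈Y = ¬Adj⇒false c x y λ e →
          InY-not-odd (∈decSubset⁻ InY? y∈Y) (odd-from-InY (∈decSubset⁻ InY? x∈Y) c y e)

    independent-or-progress : ProgressOr s (BigIndependent G)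
    independent-or-progress = do
      w-odd    ← saturated-or-progress P s>0 s+2≤n F w w∉P
      even-odd ← allUpTo-or-progress (λ j → (even j Boolₚ.≟ true) →-dec OddFrom? (vert P j)) (suc s) odd-from-even
      inj₂ (bigIndependent (λ c y → proj₂ (w-odd c) y) even-odd)

  step : ∀ {s} (P : RainbowPath s) → 0 < s → s + 2 ≤ n → 3 + s ≤ m → Progress s
  step {s} P s>0 s+2≤n 3+s≤m = settle (attempt (∃palette P 3+s≤m) (∃offPath P s+2≤n))
    where
    attempt : Palette P → (∃ λ w → ¬ OnPath P w) → ProgressOr s (BigIndependent G)
    attempt F (w , w∉P) = do
      ext ← extremal-or-progress P s>0 s+2≤n F w w∉P
      IndependentSet.independent-or-progress P s>0 s+2≤n F w w∉P ext
    settle : ProgressOr s (BigIndependent G) → Progress s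
    settle (inj₁ progress)    = progress
    settle (inj₂ independent) = inj₂ (inj₂ independent)

  grow : ∀ r {s} → r + suc s ≡ n → n < m → 0 < s → RainbowPath s →
    RainbowHamPath G ⊎ (TwoCliques G ⊎ BigIndependent G)
  grow zero    r+1+s≡n _   _   P = inj₁ (hamiltonian G P r+1+s≡n)
  grow (suc r) {s} r+1+s≡n n<m s>0 P = continue (step P s>0 (subst (_≤ n) (+-comm 2 s) 2+s≤n) (≤-trans (s≤s 2+s≤n) n<m))
    where
    2+s≤n : 2 + s ≤ n
    2+s≤n = subst (2 + s ≤_) r+1+s≡n (s≤s (m≤n+m (suc s) r))
    continue : Progress s → RainbowHamPath G ⊎ (TwoCliques G ⊎ BigIndependent G)
    continue (inj₁ P′)      = grow r (+-suc r (suc s) ⟨ trans ⟩ r+1+s≡n) n<m (s≤s z≤n) P′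
    continue (inj₂ outcome) = inj₂ outcome

edgeless : ∀ {k} n (G : Collection (suc k) (2 + n)) → (∀ c → σ₂≥ (G c) n) → (∀ c x y → adj (G c) x y ≡ false) → n ≡ 0
edgeless n G σ₂-G no-edge = n≤0⇒n≡0 (subst (n ≤_) (cong₂ _+_ (deg≡0 fzero) (deg≡0 (fsuc fzero)))
  (σ₂-G fzero fzero (fsuc fzero) (λ ()) (no-edge fzero fzero (fsuc fzero))))
  where
  deg≡0 : ∀ x → deg (G fzero) x ≡ 0
  deg≡0 x = ∣tabulate∣≡countᶠ (adj (G fzero) x)
    ⟨ trans ⟩ count-false _ (2 + n) (λ j j<n → liftℕ-fromℕ< _ j j<n ⟨ trans ⟩ no-edge fzero x _)

lemma1p9 : (k n : ℕ) → 1 ≤ k → (G : Collection (n + k) n) →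
    (∀ i → σ₂≥ (G i) (n ∸ 2)) →
    RainbowHamPath G ⊎ (TwoCliques G ⊎ BigIndependent G)
lemma1p9 k zero          _   G σ₂-G = inj₁ tt
lemma1p9 k (suc zero)    _   G σ₂-G = inj₁ (hamiltonian G (RainbowPaths.trivial G fzero fzero) refl)
lemma1p9 k (suc (suc n)) 1≤k G σ₂-G with RainbowPaths.path₁-or-edgeless G
... | inj₁ P₁      = Extension.grow G σ₂-G n (+-comm n 2) (m<m+n (2 + n) 1≤k) (s≤s z≤n) P₁
... | inj₂ no-edge with edgeless n G σ₂-G no-edge
...   | refl = inj₂ (inj₂ (1 , tabulate (λ _ → true) , refl , refl , λ c x y _ _ → no-edge c x y))
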